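{- Let $r\ge1$ and let $a_1,\dots,a_r$ be nonzero complex numbers. For every integer $n\ge0$, \begin{align*} D_{n+1}(x|a_1,\dots,a_r)&=xD_n(x-1|a_1,\dots,a_r)\\ &\quad-\sum_{m=0}^n\left(\sum_{i=m}^n\sum_{l=i}^n\sum_{j=1}^r\frac{1}{i+1}\binom{n}{l}\binom{i+1}{m}S_1(l,i)B_{i+1-m}(-a_j)^{i+1-m}D_{n-l}(a_1,\dots,a_r)\right)(x-1)^m, \end{align*} \begin{align*} \widehat D_{n+1}(x|a_1,\dots,a_r)&=\Big(x+\sum_{j=1}^ra_j\Big)\widehat D_n(x-1|a_1,\dots,a_r)\\ &\quad-\sum_{m=0}^n\left(\sum_{i=m}^n\sum_{l=i}^n\sum_{j=1}^r\frac{1}{i+1}\binom{n}{l}\binom{i+1}{m}S_1(l,i)B_{i+1-m}(-a_j)^{i+1-m}\widehat D_{n-l}(a_1,\dots,a_r)\right)(x-1)^m. \end{align*}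
   Context: For nonzero complex $a_1,\dots,a_r$, the Barnes-type Daehee polynomials of the first and second kind are defined by the formal power series identities $\prod_{j=1}^r\frac{\ln(1+t)}{(1+t)^{a_j}-1}(1+t)^x=\sum_{n\ge0}D_n(x|a_1,\dots,a_r)\frac{t^n}{n!}$ and $\prod_{j=1}^r\frac{(1+t)^{a_j}\ln(1+t)}{(1+t)^{a_j}-1}(1+t)^x=\sum_{n\ge0}\widehat D_n(x|a_1,\dots,a_r)\frac{t^n}{n!}$; the numbers are $D_n(a_1,\dots,a_r)=D_n(0|a_1,\dots,a_r)$ and $\widehat D_n(a_1,\dots,a_r)=\widehat D_n(0|a_1,\dots,a_r)$. $S_1(n,m)$ are the signed Stirling numbers of the first kind: $x(x-1)\cdots(x-n+1)=\sum_{m=0}^nS_1(n,m)x^m$. $B_n$ is the $n$th ordinary Bernoulli number, $\frac{t}{e^t-1}=\sum_{n\ge0}B_n\frac{t^n}{n!}$. -}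

module Defs where

open import Level using (Level; _⊔_) renaming (suc to lsuc)
open import Data.Nat as ℕ using (ℕ; zero; suc; _∸_; _≤?_)
open import Data.Nat.Combinatorics using (_C_)
open import Data.Nat using (_!)
open import Data.Fin using (Fin)
open import Relation.Nullary using (¬_; yes; no)
open import Algebra.Bundles using (CommutativeRing)

module _ {c ℓ : Level} (R : CommutativeRing c ℓ) where
  open CommutativeRing R
  ιR : ℕ → Carrier
  ιR zero = 0#
  ιR (suc n) = 1# + ιR n

-- A field of characteristic zero (the paper works over ℂ, which is such a field).
-- Inverses are given for nonzero elements; characteristic zero means n·1 ≠ 0 for n ≥ 1.
record Char0Field (c ℓ : Level) : Set (lsuc (c ⊔ ℓ)) where
  field
    commRing : CommutativeRing c ℓ
  open CommutativeRing commRing public hiding (ring)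
  field
    _⁻¹⟨_⟩ : (x : Carrier) → ¬ (x ≈ 0#) → Carrier
    inverseʳ : ∀ x (p : ¬ (x ≈ 0#)) → x * (x ⁻¹⟨ p ⟩) ≈ 1#
    char0 : ∀ n → ¬ (ιR commRing (suc n) ≈ 0#)

  ι : ℕ → Carrier
  ι = ιR commRing

module Daehee {c ℓ : Level} (F : Char0Field c ℓ) where
  open Char0Field F

  infixr 8 _^_
  _^_ : Carrier → ℕ → Carrier
  x ^ zero = 1#
  x ^ suc n = x * (x ^ n)

  Σ< : ℕ → (ℕ → Carrier) → Carrier
  Σ< zero f = 0#
  Σ< (suc n) f = Σ< n f + f n

  -- Σ_{k=m}^{n} f k   (empty if m > n)
  Σ[_to_] : ℕ → ℕ → (ℕ → Carrier) → Carrier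
  Σ[ m to n ] f = Σ< (suc n ∸ m) (λ k → f (m ℕ.+ k))

  ΣFin : (r : ℕ) → (Fin r → Carrier) → Carrier
  ΣFin zero f = 0#
  ΣFin (suc r) f = f Data.Fin.zero + ΣFin r (λ j → f (Data.Fin.suc j))

  inv1+ : ℕ → Carrier
  inv1+ n = ι (suc n) ⁻¹⟨ char0 n ⟩

  invFact : ℕ → Carrier
  invFact zero = 1#
  invFact (suc n) = inv1+ n * invFact n

  -- signed Stirling numbers of the first kind:
  -- x(x-1)...(x-n+1) = Σ_m S₁(n,m) x^m
  S₁ : ℕ → ℕ → Carrier
  S₁ zero zero = 1#
  S₁ zero (suc m) = 0#
  S₁ (suc n) zero = 0#
  S₁ (suc n) (suc m) = S₁ n m - ι n * S₁ n (suc m)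

  -- Formal power series: coefficient sequences
  Series : Set c
  Series = ℕ → Carrier

  oneS : Series
  oneS zero = 1#
  oneS (suc n) = 0#

  _·S_ : Series → Series → Series
  (f ·S g) n = Σ< (suc n) (λ k → f k * g (n ∸ k))

  -- multiplicative inverse of a series f whose constant term f 0 has inverse u
  -- h 0 = u,  h n = - u * Σ_{k=1}^{n} f k * h (n-k)
  invSApprox : Series → Carrier → ℕ → Series
  invSApprox f u zero = λ _ → u
  invSApprox f u (suc n) m with m ≤? n
  ... | yes _ = invSApprox f u n m
  ... | no _ = - (u * Σ[ 1 to suc n ] (λ k → f k * invSApprox f u n (suc n ∸ k)))

  invS : Series → Carrier → Series
  invS f u n = invSApprox f u n n

  falling : Carrier → ℕ → Carrier
  falling x zero = 1#
  falling x (suc k) = falling x k * (x - ι k)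

  -- (1+t)^x = Σ_k (x)_k / k! t^k
  binomS : Carrier → Series
  binomS x k = falling x k * invFact k

  -- ln(1+t) / t = Σ_n (-1)^n/(n+1) t^n
  logOverT : Series
  logOverT n = ((- 1#) ^ n) * inv1+ n

  -- ((1+t)^a - 1) / t : coefficient n is the coefficient of t^{n+1} in (1+t)^a
  -- (constant term a)
  expmOverT : Carrier → Series
  expmOverT a n = binomS a (suc n)

  -- the series ln(1+t) / ((1+t)^a - 1) = (ln(1+t)/t) / (((1+t)^a - 1)/t), for a ≠ 0
  daeheeFactor : (a : Carrier) → ¬ (a ≈ 0#) → Series
  daeheeFactor a p = logOverT ·S invS (expmOverT a) (a ⁻¹⟨ p ⟩)

  ΠS : (r : ℕ) → (Fin r → Series) → Series
  ΠS zero f = oneS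
  ΠS (suc r) f = f Data.Fin.zero ·S ΠS r (λ j → f (Data.Fin.suc j))

  -- Barnes-type Daehee polynomials of the first kind:
  -- Π_j ln(1+t)/((1+t)^{a_j}-1) · (1+t)^x = Σ_n D_n(x|a) t^n/n!
  D : (r : ℕ) (a : Fin r → Carrier) → (∀ j → ¬ (a j ≈ 0#)) → ℕ → Carrier → Carrier
  D r a a≠0 n x = ι (n !) * ((ΠS r (λ j → daeheeFactor (a j) (a≠0 j)) ·S binomS x) n)

  -- second kind:
  -- Π_j (1+t)^{a_j} ln(1+t)/((1+t)^{a_j}-1) · (1+t)^x = Σ_n D̂_n(x|a) t^n/n!
  D̂ : (r : ℕ) (a : Fin r → Carrier) → (∀ j → ¬ (a j ≈ 0#)) → ℕ → Carrier → Carrier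
  D̂ r a a≠0 n x =
    ι (n !) * ((ΠS r (λ j → binomS (a j) ·S daeheeFactor (a j) (a≠0 j)) ·S binomS x) n)

  -- Bernoulli numbers: t/(e^t - 1) = Σ_n B_n t^n/n!
  -- (e^t - 1)/t = Σ_n t^n/(n+1)!, constant term 1
  expmOverT₁ : Series
  expmOverT₁ n = invFact (suc n)

  B : ℕ → Carrier
  B n = ι (n !) * invS expmOverT₁ 1# n

module Submission where

-- Work in R[[t]] (coefficient sequences) and write s = ln(1+t).  The
-- factor ln(1+t)/((1+t)^a - 1) is φ(s) with φ(s) = s/(e^{as} - 1), and the
-- Bernoulli identity φ' = -φ C₀, C₀(s) = (β(-as) - 1)/s with β(s) = s/(e^s-1),
-- becomes, via the chain rule (1+t) d/dt = d/ds, the statement that the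
-- factor has logarithmic θ-derivative -Λ, where θ = (1+t) d/dt and Λ = C₀(s).
-- Logarithmic derivatives add over products, (1+t)^a contributes a, and
-- (1+t)^x = (1+t)(1+t)^{x-1}; together this gives the derivative of the
-- whole generating function, whose t^n-coefficient is the recurrence.

open import Defs
open import Data.Nat using (ℕ; suc; _∸_; _≤_)
open import Data.Nat.Combinatorics using (_C_)
open import Data.Fin using (Fin)
open import Data.Product using (_×_; _,_)
open import Relation.Nullary using (¬_; yes; no)
open import Algebra.Bundles using (CommutativeRing)

-- The standard library's ring solver needs a coefficient ring mapping into
-- the ring at hand; this module supplies the canonical homomorphism ℤ → R
-- for an arbitrary commutative ring R and re-exports the resulting solver.
module IntegerSolver {c ℓ} (R : CommutativeRing c ℓ) where
  open import Data.Nat as ℕ using (ℕ; zero; suc)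
  import Data.Nat.Properties as NP
  open import Data.Integer as ℤ using (ℤ; +_; -[1+_])
  import Data.Integer.Properties as ℤP
  open import Data.Sign as Sign using (Sign)
  open import Data.Maybe using (Maybe; just; nothing)
  import Relation.Binary.PropositionalEquality as P
  open import Algebra.Solver.Ring.AlmostCommutativeRing
    using (fromCommutativeRing; _-Raw-AlmostCommutative⟶_)
  open CommutativeRing R
  open import Algebra.Properties.Ring ring using (-‿involutive; -0#≈0#; -‿+-comm; -1*x≈-x)
  import Algebra.Properties.Semiring.Mult semiring as Mult
  open import Algebra.Properties.Semiring.Mult.TCOptimised semiring
    using (1+×; ×-homo-+; ×1-homo-*) renaming (_×_ to _×′_)
  open import Relation.Binary.Reasoning.Setoid setoid

  ι : ℕ → Carrier
  ι = ιR R

  ι≈× : ∀ n → ι n ≈ n Mult.× 1#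
  ι≈× zero = refl
  ι≈× (suc n) = +-congˡ (ι≈× n)

  ι-+ : ∀ m n → ι (m ℕ.+ n) ≈ ι m + ι n
  ι-+ m n = trans (ι≈× (m ℕ.+ n)) (trans (Mult.×-homo-+ 1# m n) (sym (+-cong (ι≈× m) (ι≈× n))))

  ι-* : ∀ m n → ι (m ℕ.* n) ≈ ι m * ι n
  ι-* m n = trans (ι≈× (m ℕ.* n)) (trans (Mult.×1-homo-* m n) (sym (*-cong (ι≈× m) (ι≈× n))))

  -- the canonical ring homomorphism ℤ → R; the type-checking optimised
  -- ℕ-action is used so that the integers 0 and 1 map to 0# and 1# on the nose
  ⟦_⟧ℤ : ℤ → Carrier
  ⟦ + n ⟧ℤ = n ×′ 1#
  ⟦ -[1+ n ] ⟧ℤ = - (suc n ×′ 1#)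

  ⟦⟧-neg : ∀ i → ⟦ ℤ.- i ⟧ℤ ≈ - ⟦ i ⟧ℤ
  ⟦⟧-neg -[1+ n ] = sym (-‿involutive _)
  ⟦⟧-neg (+ zero) = sym -0#≈0#
  ⟦⟧-neg (+ suc n) = refl

  difference-translate : ∀ a x y → x - y ≈ (a + x) - (a + y)
  difference-translate a x y = sym (begin
    (a + x) - (a + y)       ≈⟨ +-congˡ (-‿+-comm a y) ⟨
    (a + x) + (- a - y)     ≈⟨ +-assoc a x _ ⟩
    a + (x + (- a - y))     ≈⟨ +-congˡ (trans (sym (+-assoc x _ _)) (trans (+-congʳ (+-comm x _)) (+-assoc _ x _))) ⟩
    a + (- a + (x - y))     ≈⟨ +-assoc a _ _ ⟨
    (a - a) + (x - y)       ≈⟨ trans (+-congʳ (-‿inverseʳ a)) (+-identityˡ _) ⟩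
    x - y                   ∎)

  ⟦⟧-⊖ : ∀ m n → ⟦ m ℤ.⊖ n ⟧ℤ ≈ m ×′ 1# - n ×′ 1#
  ⟦⟧-⊖ zero zero = sym (-‿inverseʳ 0#)
  ⟦⟧-⊖ (suc m) zero = sym (trans (+-congˡ -0#≈0#) (+-identityʳ _))
  ⟦⟧-⊖ zero (suc n) = sym (+-identityˡ _)
  ⟦⟧-⊖ (suc m) (suc n) = begin
    ⟦ suc m ℤ.⊖ suc n ⟧ℤ                  ≡⟨ P.cong ⟦_⟧ℤ (ℤP.[1+m]⊖[1+n]≡m⊖n m n) ⟩
    ⟦ m ℤ.⊖ n ⟧ℤ                          ≈⟨ ⟦⟧-⊖ m n ⟩
    m ×′ 1# - n ×′ 1#                     ≈⟨ difference-translate 1# _ _ ⟩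
    (1# + m ×′ 1#) - (1# + n ×′ 1#)       ≈⟨ +-cong (1+× m 1#) (-‿cong (1+× n 1#)) ⟨
    suc m ×′ 1# - suc n ×′ 1#             ∎

  ⟦⟧-+ : ∀ i j → ⟦ i ℤ.+ j ⟧ℤ ≈ ⟦ i ⟧ℤ + ⟦ j ⟧ℤ
  ⟦⟧-+ -[1+ m ] -[1+ n ] = begin
    - (suc (suc (m ℕ.+ n)) ×′ 1#)          ≡⟨ P.cong (λ k → - (suc k ×′ 1#)) (NP.+-suc m n) ⟨
    - ((suc m ℕ.+ suc n) ×′ 1#)            ≈⟨ -‿cong (×-homo-+ 1# (suc m) (suc n)) ⟩
    - (suc m ×′ 1# + suc n ×′ 1#)          ≈⟨ -‿+-comm _ _ ⟨
    - (suc m ×′ 1#) - (suc n ×′ 1#)        ∎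
  ⟦⟧-+ -[1+ m ] (+ n) = trans (⟦⟧-⊖ n (suc m)) (+-comm _ _)
  ⟦⟧-+ (+ m) -[1+ n ] = ⟦⟧-⊖ m (suc n)
  ⟦⟧-+ (+ m) (+ n) = ×-homo-+ 1# m n

  -- multiplication is handled through the decomposition i = sign i ◃ ∣ i ∣
  ⟦_⟧sign : Sign → Carrier
  ⟦ Sign.+ ⟧sign = 1#
  ⟦ Sign.- ⟧sign = - 1#

  ⟦⟧-◃ : ∀ s n → ⟦ s ℤ.◃ n ⟧ℤ ≈ ⟦ s ⟧sign * n ×′ 1#
  ⟦⟧-◃ s zero = sym (zeroʳ _)
  ⟦⟧-◃ Sign.+ (suc n) = sym (*-identityˡ _)
  ⟦⟧-◃ Sign.- (suc n) = sym (-1*x≈-x _)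

  ⟦⟧-signAbs : ∀ i → ⟦ i ⟧ℤ ≈ ⟦ ℤ.sign i ⟧sign * ℤ.∣ i ∣ ×′ 1#
  ⟦⟧-signAbs (+ n) = sym (*-identityˡ _)
  ⟦⟧-signAbs -[1+ n ] = sym (-1*x≈-x _)

  ⟦⟧sign-* : ∀ s t → ⟦ s Sign.* t ⟧sign ≈ ⟦ s ⟧sign * ⟦ t ⟧sign
  ⟦⟧sign-* Sign.+ t = sym (*-identityˡ _)
  ⟦⟧sign-* Sign.- Sign.+ = sym (*-identityʳ _)
  ⟦⟧sign-* Sign.- Sign.- = sym (trans (-1*x≈-x _) (-‿involutive _))

  ⟦⟧-* : ∀ i j → ⟦ i ℤ.* j ⟧ℤ ≈ ⟦ i ⟧ℤ * ⟦ j ⟧ℤ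
  ⟦⟧-* i j = begin
    ⟦ (s Sign.* t) ℤ.◃ (m ℕ.* n) ⟧ℤ          ≈⟨ ⟦⟧-◃ (s Sign.* t) (m ℕ.* n) ⟩
    ⟦ s Sign.* t ⟧sign * (m ℕ.* n) ×′ 1#     ≈⟨ *-cong (⟦⟧sign-* s t) (×1-homo-* m n) ⟩
    (⟦ s ⟧sign * ⟦ t ⟧sign) * (m ×′ 1# * n ×′ 1#)
      ≈⟨ trans (*-assoc _ _ _) (trans (*-congˡ (trans (sym (*-assoc _ _ _)) (trans (*-congʳ (*-comm _ _)) (*-assoc _ _ _)))) (sym (*-assoc _ _ _))) ⟩
    (⟦ s ⟧sign * m ×′ 1#) * (⟦ t ⟧sign * n ×′ 1#) ≈⟨ *-cong (⟦⟧-signAbs i) (⟦⟧-signAbs j) ⟨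
    ⟦ i ⟧ℤ * ⟦ j ⟧ℤ                           ∎
    where
    s t : Sign
    s = ℤ.sign i
    t = ℤ.sign j
    m n : ℕ
    m = ℤ.∣ i ∣
    n = ℤ.∣ j ∣

  ℤ⟶R : CommutativeRing.rawRing ℤP.+-*-commutativeRing -Raw-AlmostCommutative⟶ fromCommutativeRing R
  ℤ⟶R = record
    { ⟦_⟧ = ⟦_⟧ℤ ; +-homo = ⟦⟧-+ ; *-homo = ⟦⟧-* ; -‿homo = ⟦⟧-neg
    ; 0-homo = refl ; 1-homo = refl }

  ⟦⟧-weaklyDecidable : ∀ i j → Maybe (⟦ i ⟧ℤ ≈ ⟦ j ⟧ℤ)
  ⟦⟧-weaklyDecidable i j with i ℤP.≟ j
  ... | yes P.refl = just refl
  ... | no _ = nothing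

  open import Algebra.Solver.Ring _ _ ℤ⟶R ⟦⟧-weaklyDecidable public

module Arithmetic {c ℓ} (F : Char0Field c ℓ) where
  open import Data.Nat using (suc)
  open import Data.Integer using (+_)
  open Char0Field F
  open Daehee F
  open import Algebra.Properties.Ring (CommutativeRing.ring commRing) public
  open import Relation.Binary.Reasoning.Setoid setoid public
  open IntegerSolver commRing public using (ι-+; ι-*; solve; _:=_; _:+_; _:*_; _:-_; :-_)
  private module Solver = IntegerSolver commRing

  :0 :1 : ∀ {m} → Solver.Polynomial m
  :0 = Solver.con (+ 0)
  :1 = Solver.con (+ 1)

  inv1+-inverseˡ : ∀ n → inv1+ n * ι (suc n) ≈ 1#
  inv1+-inverseˡ n = trans (*-comm _ _) (inverseʳ _ (char0 n))

  inv1+-inverseʳ : ∀ n → ι (suc n) * inv1+ n ≈ 1#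
  inv1+-inverseʳ n = inverseʳ _ (char0 n)

  ι-cancel : ∀ n {a b} → ι (suc n) * a ≈ ι (suc n) * b → a ≈ b
  ι-cancel n {a} {b} e = begin
    a                        ≈⟨ *-identityˡ a ⟨
    1# * a                   ≈⟨ *-congʳ (inv1+-inverseˡ n) ⟨
    inv1+ n * ι (suc n) * a  ≈⟨ trans (*-assoc _ _ _) (trans (*-congˡ e) (sym (*-assoc _ _ _))) ⟩
    inv1+ n * ι (suc n) * b  ≈⟨ *-congʳ (inv1+-inverseˡ n) ⟩
    1# * b                   ≈⟨ *-identityˡ b ⟩
    b                        ∎

module FiniteSums {c ℓ} (F : Char0Field c ℓ) where
  open import Data.Nat using (ℕ; zero; suc; _∸_; _≤_; _<_)
  import Data.Nat.Properties as NP
  open import Data.Fin as Fin using (Fin)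
  import Relation.Binary.PropositionalEquality as P
  open Char0Field F
  open Daehee F
  open Arithmetic F

  Σ-cong : ∀ n {f g : ℕ → Carrier} → (∀ k → f k ≈ g k) → Σ< n f ≈ Σ< n g
  Σ-cong zero e = refl
  Σ-cong (suc n) e = +-cong (Σ-cong n e) (e n)

  Σ-cong< : ∀ n {f g : ℕ → Carrier} → (∀ k → k < n → f k ≈ g k) → Σ< n f ≈ Σ< n g
  Σ-cong< zero e = refl
  Σ-cong< (suc n) e = +-cong (Σ-cong< n (λ k k<n → e k (NP.m<n⇒m<1+n k<n))) (e n NP.≤-refl)

  Σ-+ : ∀ n (f g : ℕ → Carrier) → Σ< n (λ k → f k + g k) ≈ Σ< n f + Σ< n g
  Σ-+ zero f g = sym (+-identityˡ _)
  Σ-+ (suc n) f g = trans (+-congʳ (Σ-+ n f g))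
    (solve 4 (λ a b c d → (a :+ b) :+ (c :+ d) := (a :+ c) :+ (b :+ d)) refl _ _ _ _)

  Σ-0 : ∀ n → Σ< n (λ _ → 0#) ≈ 0#
  Σ-0 zero = refl
  Σ-0 (suc n) = trans (+-identityʳ _) (Σ-0 n)

  Σ-*ˡ : ∀ n a (f : ℕ → Carrier) → a * Σ< n f ≈ Σ< n (λ k → a * f k)
  Σ-*ˡ zero a f = zeroʳ a
  Σ-*ˡ (suc n) a f = trans (distribˡ _ _ _) (+-congʳ (Σ-*ˡ n a f))

  Σ-*ʳ : ∀ n a (f : ℕ → Carrier) → Σ< n f * a ≈ Σ< n (λ k → f k * a)
  Σ-*ʳ n a f = trans (*-comm _ _) (trans (Σ-*ˡ n a f) (Σ-cong n (λ k → *-comm _ _)))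

  Σ-neg : ∀ n (f : ℕ → Carrier) → Σ< n (λ k → - f k) ≈ - Σ< n f
  Σ-neg zero f = sym -0#≈0#
  Σ-neg (suc n) f = trans (+-congʳ (Σ-neg n f)) (-‿+-comm _ _)

  Σ-first : ∀ n (f : ℕ → Carrier) → Σ< (suc n) f ≈ f 0 + Σ< n (λ k → f (suc k))
  Σ-first zero f = trans (+-identityˡ _) (sym (+-identityʳ _))
  Σ-first (suc n) f = trans (+-congʳ (Σ-first n f)) (+-assoc _ _ _)

  Σ-swap : ∀ a b (g : ℕ → ℕ → Carrier) →
    Σ< a (λ i → Σ< b (λ j → g i j)) ≈ Σ< b (λ j → Σ< a (λ i → g i j))
  Σ-swap zero b g = sym (Σ-0 b)
  Σ-swap (suc a) b g = trans (+-congʳ (Σ-swap a b g)) (sym (Σ-+ b _ _))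

  Σ-reverse : ∀ n (f : ℕ → Carrier) → Σ< (suc n) f ≈ Σ< (suc n) (λ k → f (n ∸ k))
  Σ-reverse zero f = refl
  Σ-reverse (suc n) f = begin
    Σ< (suc n) f + f (suc n)                     ≈⟨ +-congʳ (Σ-reverse n f) ⟩
    Σ< (suc n) (λ k → f (n ∸ k)) + f (suc n)     ≈⟨ +-comm _ _ ⟩
    f (suc n) + Σ< (suc n) (λ k → f (n ∸ k))     ≈⟨ Σ-first (suc n) (λ k → f (suc n ∸ k)) ⟨
    Σ< (suc (suc n)) (λ k → f (suc n ∸ k))       ∎

  Σ-sandwich : ∀ n a b (f : ℕ → Carrier) → a * Σ< n f * b ≈ Σ< n (λ k → a * f k * b)
  Σ-sandwich n a b f = trans (*-congʳ (Σ-*ˡ n a f)) (Σ-*ʳ n b _)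

  ΣFin-cong : ∀ r {f g : Fin r → Carrier} → (∀ j → f j ≈ g j) → ΣFin r f ≈ ΣFin r g
  ΣFin-cong zero e = refl
  ΣFin-cong (suc r) e = +-cong (e Fin.zero) (ΣFin-cong r (λ j → e (Fin.suc j)))

  ΣFin-0 : ∀ r → ΣFin r (λ _ → 0#) ≈ 0#
  ΣFin-0 zero = refl
  ΣFin-0 (suc r) = trans (+-identityˡ _) (ΣFin-0 r)

  ΣFin-*ʳ : ∀ r a (f : Fin r → Carrier) → ΣFin r f * a ≈ ΣFin r (λ k → f k * a)
  ΣFin-*ʳ zero a f = zeroˡ a
  ΣFin-*ʳ (suc r) a f = trans (distribʳ _ _ _) (+-congˡ (ΣFin-*ʳ r a _))

  ΣFin-*ˡ : ∀ r a (f : Fin r → Carrier) → a * ΣFin r f ≈ ΣFin r (λ k → a * f k)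
  ΣFin-*ˡ r a f = trans (*-comm _ _) (trans (ΣFin-*ʳ r a f) (ΣFin-cong r (λ k → *-comm _ _)))

  ΣFin-sandwich : ∀ r a b (f : Fin r → Carrier) → a * ΣFin r f * b ≈ ΣFin r (λ k → a * f k * b)
  ΣFin-sandwich r a b f = trans (*-congʳ (ΣFin-*ˡ r a f)) (ΣFin-*ʳ r b _)

  ΣFin-Σ : ∀ r n (g : Fin r → ℕ → Carrier) →
    ΣFin r (λ j → Σ< n (g j)) ≈ Σ< n (λ k → ΣFin r (λ j → g j k))
  ΣFin-Σ zero n g = sym (Σ-0 n)
  ΣFin-Σ (suc r) n g = trans (+-congˡ (ΣFin-Σ r n _)) (sym (Σ-+ n _ _))

  Σto-empty : ∀ n (f : ℕ → Carrier) → Σ[ suc n to n ] f ≈ 0#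
  Σto-empty n f rewrite NP.n∸n≡0 n = refl

  Σto-last : ∀ i n (f : ℕ → Carrier) → i ≤ suc n →
    Σ[ i to suc n ] f ≈ Σ[ i to n ] f + f (suc n)
  Σto-last i n f i≤ rewrite NP.+-∸-assoc 1 {suc n} {i} i≤ =
    +-congˡ (reflexive (P.cong f (NP.m+[n∸m]≡n i≤)))

  Σ-triangle : ∀ n (G : ℕ → ℕ → Carrier) →
    Σ< (suc n) (λ l → Σ< (suc l) (λ i → G i l)) ≈ Σ< (suc n) (λ i → Σ[ i to n ] (G i))
  Σ-triangle zero G = refl
  Σ-triangle (suc n) G = begin
    Σ< (suc n) (λ l → Σ< (suc l) (λ i → G i l)) + Σ< (suc (suc n)) (λ i → G i (suc n))
      ≈⟨ +-congʳ (Σ-triangle n G) ⟩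
    Σ< (suc n) (λ i → Σ[ i to n ] (G i)) + Σ< (suc (suc n)) (λ i → G i (suc n))
      ≈⟨ +-congʳ (trans (+-congˡ (Σto-empty n (G (suc n)))) (+-identityʳ _)) ⟨
    Σ< (suc (suc n)) (λ i → Σ[ i to n ] (G i)) + Σ< (suc (suc n)) (λ i → G i (suc n))
      ≈⟨ Σ-+ (suc (suc n)) _ _ ⟨
    Σ< (suc (suc n)) (λ i → Σ[ i to n ] (G i) + G i (suc n))
      ≈⟨ Σ-cong< (suc (suc n)) (λ i i< → sym (Σto-last i n (G i) (NP.≤-pred i<))) ⟩
    Σ< (suc (suc n)) (λ i → Σ[ i to suc n ] (G i)) ∎

-- The formal power series R[[t]] (coefficient sequences with the Cauchy
-- product _·S_ of Defs) form a commutative ring; packaging them as a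
-- CommutativeRing lets the ring solver reason about series identities.
module PowerSeries {c ℓ} (F : Char0Field c ℓ) where
  open import Data.Nat using (zero; suc; _∸_; _≤_)
  import Data.Nat.Properties as NP
  import Relation.Binary.PropositionalEquality as P
  open Char0Field F
  open Daehee F
  open Arithmetic F
  open FiniteSums F

  infix 4 _≈S_
  _≈S_ : Series → Series → Set ℓ
  f ≈S g = ∀ n → f n ≈ g n

  reflS : ∀ {f} → f ≈S f
  reflS n = refl

  symS : ∀ {f g} → f ≈S g → g ≈S f
  symS e n = sym (e n)

  transS : ∀ {f g h} → f ≈S g → g ≈S h → f ≈S h
  transS e e' n = trans (e n) (e' n)

  infixl 6 _+S_ _-S_
  infixr 7 _⋅_

  _+S_ : Series → Series → Series
  (f +S g) n = f n + g n

  -S_ : Series → Series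
  (-S f) n = - f n

  _-S_ : Series → Series → Series
  f -S g = f +S (-S g)

  zeroS : Series
  zeroS n = 0#

  _⋅_ : Carrier → Series → Series
  (a ⋅ f) n = a * f n

  difference-zero : ∀ {f g} → f ≈S g → f -S g ≈S zeroS
  difference-zero e n = trans (+-congʳ (e n)) (-‿inverseʳ _)

  from-difference-zero : ∀ {f g} → f -S g ≈S zeroS → f ≈S g
  from-difference-zero {f} {g} e n = begin
    f n                  ≈⟨ solve 2 (λ x y → x := (x :- y) :+ y) refl _ _ ⟩
    (f n - g n) + g n    ≈⟨ +-congʳ (e n) ⟩
    0# + g n             ≈⟨ +-identityˡ _ ⟩
    g n                  ∎

  ·S-cong : ∀ {f f' g g'} → f ≈S f' → g ≈S g' → f ·S g ≈S f' ·S g'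
  ·S-cong e e' n = Σ-cong (suc n) (λ k → *-cong (e k) (e' (n ∸ k)))

  ·S-congˡ : ∀ {f f'} g → f ≈S f' → f ·S g ≈S f' ·S g
  ·S-congˡ g e = ·S-cong e (reflS {g})

  ·S-congʳ : ∀ f {g g'} → g ≈S g' → f ·S g ≈S f ·S g'
  ·S-congʳ f e = ·S-cong (reflS {f}) e

  ·S-comm : ∀ f g → f ·S g ≈S g ·S f
  ·S-comm f g n = begin
    Σ< (suc n) (λ k → f k * g (n ∸ k))              ≈⟨ Σ-reverse n _ ⟩
    Σ< (suc n) (λ k → f (n ∸ k) * g (n ∸ (n ∸ k)))  ≈⟨ Σ-cong< (suc n) (λ k k< →
        trans (*-comm _ _) (*-congʳ (reflexive (P.cong g (NP.m∸[m∸n]≡n (NP.≤-pred k<)))))) ⟩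
    Σ< (suc n) (λ k → g k * f (n ∸ k))              ∎

  ·S-assoc : ∀ f g h → (f ·S g) ·S h ≈S f ·S (g ·S h)
  ·S-assoc f g h n = begin
    Σ< (suc n) (λ k → Σ< (suc k) (λ j → f j * g (k ∸ j)) * h (n ∸ k))
      ≈⟨ Σ-cong (suc n) (λ k → Σ-*ʳ (suc k) _ _) ⟩
    Σ< (suc n) (λ k → Σ< (suc k) (λ j → f j * g (k ∸ j) * h (n ∸ k)))
      ≈⟨ Σ-triangle n (λ j k → f j * g (k ∸ j) * h (n ∸ k)) ⟩
    Σ< (suc n) (λ j → Σ[ j to n ] (λ k → f j * g (k ∸ j) * h (n ∸ k)))
      ≈⟨ Σ-cong< (suc n) (λ j j< → inner j (NP.≤-pred j<)) ⟩
    Σ< (suc n) (λ j → f j * Σ< (suc (n ∸ j)) (λ i → g i * h ((n ∸ j) ∸ i))) ∎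
    where
    -- reindexing k = j + i in the inner sum
    inner : ∀ j → j ≤ n → Σ[ j to n ] (λ k → f j * g (k ∸ j) * h (n ∸ k))
                        ≈ f j * Σ< (suc (n ∸ j)) (λ i → g i * h ((n ∸ j) ∸ i))
    inner j j≤ rewrite NP.+-∸-assoc 1 j≤ = trans (Σ-cong (suc (n ∸ j)) (λ i →
       trans (*-assoc _ _ _) (*-congˡ (*-cong (reflexive (P.cong g (NP.m+n∸m≡n j i)))
          (reflexive (P.cong h (P.sym (NP.∸-+-assoc n j i))))))))
       (sym (Σ-*ˡ (suc (n ∸ j)) _ _))

  ·S-distribʳ : ∀ f g h → (g +S h) ·S f ≈S g ·S f +S h ·S f
  ·S-distribʳ f g h n = trans (Σ-cong (suc n) (λ k → distribʳ _ _ _)) (Σ-+ (suc n) _ _)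

  ·S-distribˡ : ∀ f g h → f ·S (g +S h) ≈S f ·S g +S f ·S h
  ·S-distribˡ f g h n = trans (Σ-cong (suc n) (λ k → distribˡ _ _ _)) (Σ-+ (suc n) _ _)

  ·S-⋅ˡ : ∀ a f g → (a ⋅ f) ·S g ≈S a ⋅ (f ·S g)
  ·S-⋅ˡ a f g n = trans (Σ-cong (suc n) (λ k → *-assoc _ _ _)) (sym (Σ-*ˡ (suc n) _ _))

  ·S-⋅ʳ : ∀ a f g → f ·S (a ⋅ g) ≈S a ⋅ (f ·S g)
  ·S-⋅ʳ a f g = transS (·S-comm f (a ⋅ g)) (transS (·S-⋅ˡ a g f) (λ n → *-congˡ (·S-comm g f n)))

  oneS-identityˡ : ∀ f → oneS ·S f ≈S f
  oneS-identityˡ f n = begin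
    Σ< (suc n) (λ k → oneS k * f (n ∸ k))         ≈⟨ Σ-first n _ ⟩
    1# * f n + Σ< n (λ k → 0# * f (n ∸ suc k))    ≈⟨ +-cong (*-identityˡ _) (trans (Σ-cong n (λ k → zeroˡ _)) (Σ-0 n)) ⟩
    f n + 0#                                      ≈⟨ +-identityʳ _ ⟩
    f n                                           ∎

  oneS-identityʳ : ∀ f → f ·S oneS ≈S f
  oneS-identityʳ f = transS (·S-comm f oneS) (oneS-identityˡ f)

  ⋅-as-product : ∀ b f → b ⋅ f ≈S (b ⋅ oneS) ·S f
  ⋅-as-product b f = symS (transS (·S-⋅ˡ b oneS f) (λ n → *-congˡ (oneS-identityˡ f n)))

  seriesRing : CommutativeRing c ℓ
  seriesRing = record
    { Carrier = Series ; _≈_ = _≈S_ ; _+_ = _+S_ ; _*_ = _·S_ ; -_ = -S_ ; 0# = zeroS ; 1# = oneS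
    ; isCommutativeRing = record
      { isRing = record
        { +-isAbelianGroup = record
          { isGroup = record
            { isMonoid = record
              { isSemigroup = record
                { isMagma = record
                  { isEquivalence = record { refl = reflS ; sym = symS ; trans = transS }
                  ; ∙-cong = λ e e' n → +-cong (e n) (e' n) }
                ; assoc = λ f g h n → +-assoc _ _ _ }
              ; identity = (λ f n → +-identityˡ _) , (λ f n → +-identityʳ _) }
            ; inverse = (λ f n → -‿inverseˡ _) , (λ f n → -‿inverseʳ _)
            ; ⁻¹-cong = λ e n → -‿cong (e n) }
          ; comm = λ f g n → +-comm _ _ }
        ; *-cong = ·S-cong
        ; *-assoc = ·S-assoc
        ; *-identity = oneS-identityˡ , oneS-identityʳ
        ; distrib = ·S-distribˡ , ·S-distribʳ }
      ; *-comm = ·S-comm } }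

  module SR = CommutativeRing seriesRing using (+-cong; *-cong; -‿cong)

  module SeriesSolver where
    open import Data.Integer using (+_)
    private module S = IntegerSolver seriesRing
    open S public using () renaming
      (solve to solveS; _:=_ to _≐_; _:+_ to _⊕_; _:*_ to _⊗_; _:-_ to _⊖_; :-_ to ⊝_)

    ⊘ ① : ∀ {m} → S.Polynomial m
    ⊘ = S.con (+ 0)
    ① = S.con (+ 1)

  shift : Series → Series
  shift f zero = 0#
  shift f (suc n) = f n

  shift-cong : ∀ {f g} → f ≈S g → shift f ≈S shift g
  shift-cong e zero = refl
  shift-cong e (suc n) = e n

  shift-·S : ∀ f g → shift f ·S g ≈S shift (f ·S g)
  shift-·S f g zero = trans (+-identityˡ _) (zeroˡ _)
  shift-·S f g (suc n) = trans (Σ-first (suc n) _) (trans (+-congʳ (zeroˡ _)) (+-identityˡ _))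

  tS : Series
  tS = shift oneS

  shift-as-product : ∀ f → shift f ≈S tS ·S f
  shift-as-product f = symS (transS (shift-·S oneS f) (shift-cong (oneS-identityˡ f)))

  tS-cancel : ∀ {f g} → tS ·S f ≈S tS ·S g → f ≈S g
  tS-cancel {f} {g} e n = transS (shift-as-product f) (transS e (symS (shift-as-product g))) (suc n)

-- Over a field of
-- characteristic zero a series is determined by its constant term together
-- with the recursion coming from a first-order differential equation.
module Derivations {c ℓ} (F : Char0Field c ℓ) where
  open import Data.Nat as ℕ using (ℕ; zero; suc; _∸_; _≤_)
  import Data.Nat.Properties as NP
  import Relation.Binary.PropositionalEquality as P
  open Char0Field F
  open Daehee F
  open Arithmetic F
  open FiniteSums F
  open PowerSeries F

  -- ∂ f = f', t∂ f = t f', θ f = (1+t) f' (as coefficient sequences)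
  ∂ : Series → Series
  ∂ f n = ι (suc n) * f (suc n)

  t∂ : Series → Series
  t∂ f n = ι n * f n

  θ : Series → Series
  θ f n = ∂ f n + t∂ f n

  ∂-cong : ∀ {f g} → f ≈S g → ∂ f ≈S ∂ g
  ∂-cong e n = *-congˡ (e (suc n))

  θ-cong : ∀ {f g} → f ≈S g → θ f ≈S θ g
  θ-cong e n = +-cong (*-congˡ (e (suc n))) (*-congˡ (e n))

  shift-∂ : ∀ f → shift (∂ f) ≈S t∂ f
  shift-∂ f zero = sym (zeroˡ _)
  shift-∂ f (suc n) = refl

  ∂-shift : ∀ f → ∂ (shift f) ≈S f +S t∂ f
  ∂-shift f zero = trans (distribʳ _ _ _) (+-congʳ (*-identityˡ _))
  ∂-shift f (suc n) = trans (distribʳ _ _ _) (+-congʳ (*-identityˡ _))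

  ∂-one : ∂ oneS ≈S zeroS
  ∂-one n = zeroʳ _

  θ-one : θ oneS ≈S zeroS
  θ-one zero = trans (+-congʳ (zeroʳ _)) (trans (+-identityˡ _) (zeroˡ _))
  θ-one (suc n) = trans (+-cong (zeroʳ _) (zeroʳ _)) (+-identityˡ _)

  t∂-Leibniz : ∀ f g → t∂ (f ·S g) ≈S t∂ f ·S g +S f ·S t∂ g
  t∂-Leibniz f g n = begin
    ι n * Σ< (suc n) (λ k → f k * g (n ∸ k))        ≈⟨ Σ-*ˡ (suc n) _ _ ⟩
    Σ< (suc n) (λ k → ι n * (f k * g (n ∸ k)))      ≈⟨ Σ-cong< (suc n) (λ k k< → split k (NP.≤-pred k<)) ⟩
    Σ< (suc n) (λ k → ι k * f k * g (n ∸ k) + f k * (ι (n ∸ k) * g (n ∸ k))) ≈⟨ Σ-+ (suc n) _ _ ⟩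
    (t∂ f ·S g +S f ·S t∂ g) n                      ∎
    where
    -- the weight n of t^n splits as k + (n - k)
    split : ∀ k → k ≤ n → ι n * (f k * g (n ∸ k)) ≈ ι k * f k * g (n ∸ k) + f k * (ι (n ∸ k) * g (n ∸ k))
    split k k≤ = begin
      ι n * (f k * g (n ∸ k))                  ≈⟨ *-congʳ (reflexive (P.cong ι (P.sym (NP.m+[n∸m]≡n k≤)))) ⟩
      ι (k ℕ.+ (n ∸ k)) * (f k * g (n ∸ k))    ≈⟨ *-congʳ (ι-+ k (n ∸ k)) ⟩
      (ι k + ι (n ∸ k)) * (f k * g (n ∸ k))
        ≈⟨ solve 4 (λ a b x y → (a :+ b) :* (x :* y) := a :* x :* y :+ x :* (b :* y)) refl _ _ _ _ ⟩
      ι k * f k * g (n ∸ k) + f k * (ι (n ∸ k) * g (n ∸ k)) ∎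

  -- ∂ is a derivation, obtained from t∂ since multiplication by t is injective
  ∂-Leibniz : ∀ f g → ∂ (f ·S g) ≈S ∂ f ·S g +S f ·S ∂ g
  ∂-Leibniz f g n = begin
    ∂ (f ·S g) n                         ≈⟨ shift-∂ (f ·S g) (suc n) ⟩
    t∂ (f ·S g) (suc n)                  ≈⟨ t∂-Leibniz f g (suc n) ⟩
    (t∂ f ·S g) (suc n) + (f ·S t∂ g) (suc n)
      ≈⟨ +-cong (·S-congˡ g (symS (shift-∂ f)) (suc n)) (·S-congʳ f (symS (shift-∂ g)) (suc n)) ⟩
    (shift (∂ f) ·S g) (suc n) + (f ·S shift (∂ g)) (suc n)
      ≈⟨ +-cong (shift-·S (∂ f) g (suc n))
                (trans (·S-comm f (shift (∂ g)) (suc n)) (trans (shift-·S (∂ g) f (suc n)) (·S-comm (∂ g) f n))) ⟩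
    (∂ f ·S g) n + (f ·S ∂ g) n          ∎

  θ-Leibniz : ∀ f g → θ (f ·S g) ≈S θ f ·S g +S f ·S θ g
  θ-Leibniz f g n = begin
    ∂ (f ·S g) n + t∂ (f ·S g) n      ≈⟨ +-cong (∂-Leibniz f g n) (t∂-Leibniz f g n) ⟩
    ((∂ f ·S g) n + (f ·S ∂ g) n) + ((t∂ f ·S g) n + (f ·S t∂ g) n)
      ≈⟨ solve 4 (λ a b c e → (a :+ b) :+ (c :+ e) := (a :+ c) :+ (b :+ e)) refl _ _ _ _ ⟩
    ((∂ f ·S g) n + (t∂ f ·S g) n) + ((f ·S ∂ g) n + (f ·S t∂ g) n)
      ≈⟨ +-cong (sym (·S-distribʳ g (∂ f) (t∂ f) n)) (sym (·S-distribˡ f (∂ g) (t∂ g) n)) ⟩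
    (θ f ·S g +S f ·S θ g) n          ∎

  θ-step : ∀ X Y l → θ X l ≈ θ Y l → X l ≈ Y l → X (suc l) ≈ Y (suc l)
  θ-step X Y l e e' = ι-cancel l (begin
    ι (suc l) * X (suc l)   ≈⟨ solve 2 (λ a b → a := a :+ b :- b) refl _ _ ⟩
    θ X l - ι l * X l       ≈⟨ +-cong e (-‿cong (*-congˡ e')) ⟩
    θ Y l - ι l * Y l       ≈⟨ solve 2 (λ a b → a :+ b :- b := a) refl _ _ ⟩
    ι (suc l) * Y (suc l)   ∎)

  -- uniqueness for θ-equations whose right-hand side at order l only
  -- depends on coefficient l of the unknown (e.g. θ X = a ⋅ X)
  θ-unique : ∀ X Y → (∀ l → X l ≈ Y l → θ X l ≈ θ Y l) → X 0 ≈ Y 0 → X ≈S Y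
  θ-unique X Y e e0 zero = e0
  θ-unique X Y e e0 (suc l) = θ-step X Y l (e l ih) ih
    where
    ih : X l ≈ Y l
    ih = θ-unique X Y e e0 l

  θ-eigen-unique : ∀ a X Y → θ X ≈S a ⋅ X → θ Y ≈S a ⋅ Y → X 0 ≈ Y 0 → X ≈S Y
  θ-eigen-unique a X Y eX eY = θ-unique X Y (λ l e → trans (eX l) (trans (*-congˡ e) (sym (eY l))))

  ∂-eigen-unique : ∀ a X Y → ∂ X ≈S a ⋅ X → ∂ Y ≈S a ⋅ Y → X 0 ≈ Y 0 → X ≈S Y
  ∂-eigen-unique a X Y eX eY e0 zero = e0
  ∂-eigen-unique a X Y eX eY e0 (suc l) =
    ι-cancel l (trans (eX l) (trans (*-congˡ (∂-eigen-unique a X Y eX eY e0 l)) (sym (eY l))))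

module SeriesInverse {c ℓ} (F : Char0Field c ℓ) where
  open import Data.Nat using (zero; suc; _∸_; _≤_; z≤n; _≤?_)
  import Data.Nat.Properties as NP
  open import Relation.Binary.PropositionalEquality as P using (_≡_)
  open import Data.Empty using (⊥-elim)
  open Char0Field F
  open Daehee F
  open Arithmetic F
  open FiniteSums F
  open PowerSeries F

  -- the approximation at stage n+1 computes the new coefficient n+1
  -- (stated for any m ≡ suc n so that the case split on m ≤? n can happen)
  invSApprox-new : ∀ f u n m → m ≡ suc n → invSApprox f u (suc n) m
                 ≡ - (u * Σ< (suc n) (λ k → f (suc k) * invSApprox f u n (n ∸ k)))
  invSApprox-new f u n m e with m ≤? n
  ... | yes m≤n = ⊥-elim (NP.<-irrefl P.refl (P.subst (_≤ n) e m≤n))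
  ... | no _ = P.refl

  invSApprox-stable : ∀ f u n m → m ≤ n → invSApprox f u n m ≡ invS f u m
  invSApprox-stable f u zero zero z≤n = P.refl
  invSApprox-stable f u (suc n) m m≤ with m ≤? n
  ... | yes m≤n = invSApprox-stable f u n m m≤n
  ... | no m≰n with NP.≤-antisym m≤ (NP.≰⇒> m≰n)
  ... | P.refl = P.sym (invSApprox-new f u n (suc n) P.refl)

  invS-inverse : ∀ f u → f 0 * u ≈ 1# → f ·S invS f u ≈S oneS
  invS-inverse f u e zero = trans (+-identityˡ _) e
  invS-inverse f u e (suc n) = begin
    (f ·S invS f u) (suc n)                          ≈⟨ Σ-first (suc n) _ ⟩
    f 0 * invS f u (suc n) + Σ< (suc n) (λ k → f (suc k) * invS f u (n ∸ k))
      ≈⟨ +-cong (*-congˡ (reflexive (invSApprox-new f u n (suc n) P.refl)))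
                (Σ-cong (suc n) (λ k → *-congˡ (sym (reflexive (invSApprox-stable f u n (n ∸ k) (NP.m∸n≤m n k)))))) ⟩
    f 0 * (- (u * X)) + X                            ≈⟨ solve 3 (λ a b x → a :* (:- (b :* x)) :+ x := (:1 :- a :* b) :* x) refl (f 0) u X ⟩
    (1# - f 0 * u) * X                               ≈⟨ *-congʳ (trans (+-congˡ (-‿cong e)) (-‿inverseʳ _)) ⟩
    0# * X                                           ≈⟨ zeroˡ _ ⟩
    0#                                               ∎
    where
    X : Carrier
    X = Σ< (suc n) (λ k → f (suc k) * invSApprox f u n (n ∸ k))

module Factorials {c ℓ} (F : Char0Field c ℓ) where
  open import Data.Nat as ℕ using (ℕ; zero; suc; _∸_; _≤_; _!)
  import Data.Nat.Properties as NP
  open import Data.Nat.Combinatorics using (_C_; nCk≡n!/k![n-k]!; k![n∸k]!∣n!)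
  open import Data.Nat.DivMod using (m/n*n≡m)
  open import Relation.Binary.PropositionalEquality as P using (_≡_)
  open Char0Field F
  open Daehee F
  open Arithmetic F

  nCk*k!*[n∸k]! : ∀ {n k} → k ≤ n → (n C k) ℕ.* ((k !) ℕ.* ((n ∸ k) !)) ≡ n !
  nCk*k!*[n∸k]! {n} {k} k≤n = P.trans (P.cong (ℕ._* ((k !) ℕ.* ((n ∸ k) !))) (nCk≡n!/k![n-k]! k≤n))
    (m/n*n≡m {{NP._!*_!≢0 k (n ∸ k)}} (k![n∸k]!∣n! k≤n))

  ι-suc! : ∀ n → ι (suc n !) ≈ ι (suc n) * ι (n !)
  ι-suc! n = ι-* (suc n) (n !)

  invFact-inverseˡ : ∀ n → invFact n * ι (n !) ≈ 1#
  invFact-inverseˡ zero = trans (*-identityˡ _) (+-identityʳ _)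
  invFact-inverseˡ (suc n) = begin
    inv1+ n * invFact n * ι (suc n !)                ≈⟨ *-congˡ (ι-suc! n) ⟩
    inv1+ n * invFact n * (ι (suc n) * ι (n !))
      ≈⟨ solve 4 (λ a b c e → a :* b :* (c :* e) := (a :* c) :* (b :* e)) refl _ _ _ _ ⟩
    (inv1+ n * ι (suc n)) * (invFact n * ι (n !))    ≈⟨ *-cong (inv1+-inverseˡ n) (invFact-inverseˡ n) ⟩
    1# * 1#                                          ≈⟨ *-identityˡ _ ⟩
    1#                                               ∎

  invFact-inverseʳ : ∀ n → ι (n !) * invFact n ≈ 1#
  invFact-inverseʳ n = trans (*-comm _ _) (invFact-inverseˡ n)

  ι-invFact-suc : ∀ n → ι (suc n) * invFact (suc n) ≈ invFact n
  ι-invFact-suc n = trans (sym (*-assoc _ _ _)) (trans (*-congʳ (inv1+-inverseʳ n)) (*-identityˡ _))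

  ι-C : ∀ {n k} → k ≤ n → ι (n !) * invFact k * invFact (n ∸ k) ≈ ι (n C k)
  ι-C {n} {k} k≤n = begin
    ι (n !) * invFact k * invFact (n ∸ k)
      ≈⟨ *-congʳ (*-congʳ (reflexive (P.cong ι (nCk*k!*[n∸k]! k≤n)))) ⟨
    ι ((n C k) ℕ.* ((k !) ℕ.* ((n ∸ k) !))) * invFact k * invFact (n ∸ k)
      ≈⟨ *-congʳ (*-congʳ (trans (ι-* (n C k) _) (*-congˡ (ι-* (k !) ((n ∸ k) !))))) ⟩
    ι (n C k) * (ι (k !) * ι ((n ∸ k) !)) * invFact k * invFact (n ∸ k)
      ≈⟨ solve 5 (λ a b e x y → a :* (b :* e) :* x :* y := a :* ((b :* x) :* (e :* y))) refl _ _ _ _ _ ⟩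
    ι (n C k) * ((ι (k !) * invFact k) * (ι ((n ∸ k) !) * invFact (n ∸ k)))
      ≈⟨ *-congˡ (*-cong (invFact-inverseʳ k) (invFact-inverseʳ (n ∸ k))) ⟩
    ι (n C k) * (1# * 1#)              ≈⟨ trans (*-congˡ (*-identityˡ _)) (*-identityʳ _) ⟩
    ι (n C k)                          ∎

  ι!*invFact : ∀ i m → m ≤ suc i → ι (i !) * invFact m ≈ inv1+ i * ι (suc i C m) * ι ((suc i ∸ m) !)
  ι!*invFact i m m≤ = sym (begin
    inv1+ i * ι (suc i C m) * ι (k !)                      ≈⟨ *-congʳ (*-congˡ (ι-C m≤)) ⟨
    inv1+ i * (ι (suc i !) * invFact m * invFact k) * ι (k !) ≈⟨ *-congʳ (*-congˡ (*-congʳ (*-congʳ (ι-suc! i)))) ⟩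
    inv1+ i * (ι (suc i) * ι (i !) * invFact m * invFact k) * ι (k !)
      ≈⟨ solve 6 (λ v s f im ik kf → v :* (s :* f :* im :* ik) :* kf := (v :* s) :* (f :* im) :* (ik :* kf)) refl _ _ _ _ _ _ ⟩
    (inv1+ i * ι (suc i)) * (ι (i !) * invFact m) * (invFact k * ι (k !))
      ≈⟨ *-cong (*-congʳ (inv1+-inverseˡ i)) (invFact-inverseˡ k) ⟩
    1# * (ι (i !) * invFact m) * 1#                        ≈⟨ solve 1 (λ z → :1 :* z :* :1 := z) refl _ ⟩
    ι (i !) * invFact m                                    ∎)
    where
    k : ℕ
    k = suc i ∸ m

  ι!-split : ∀ {n l} → l ≤ n → ∀ u v → ι (n !) * (u * v) ≈ ι (n C l) * (ι (l !) * u) * (ι ((n ∸ l) !) * v)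
  ι!-split {n} {l} l≤n u v = begin
    ι (n !) * (u * v)
      ≈⟨ *-congʳ (reflexive (P.cong ι (nCk*k!*[n∸k]! l≤n))) ⟨
    ι ((n C l) ℕ.* ((l !) ℕ.* ((n ∸ l) !))) * (u * v)
      ≈⟨ *-congʳ (trans (ι-* (n C l) _) (*-congˡ (ι-* (l !) ((n ∸ l) !)))) ⟩
    ι (n C l) * (ι (l !) * ι ((n ∸ l) !)) * (u * v)
      ≈⟨ solve 5 (λ c f g u v → c :* (f :* g) :* (u :* v) := c :* (f :* u) :* (g :* v)) refl _ _ _ _ _ ⟩
    ι (n C l) * (ι (l !) * u) * (ι ((n ∸ l) !) * v) ∎

-- Since (ln(1+t))^i / i! = Σ_l S₁(l,i) t^l / l!,
-- the series  atLog G = Σ_l (1/l!) Σ_i S₁(l,i) i! G_i t^l  is G(ln(1+t)).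
module AtLog {c ℓ} (F : Char0Field c ℓ) where
  open import Data.Nat using (ℕ; zero; suc; _<_; s≤s; _!)
  import Data.Nat.Properties as NP
  open Char0Field F
  open Daehee F
  open Arithmetic F
  open FiniteSums F
  open PowerSeries F
  open Derivations F
  open Factorials F

  stirlingSum : Series → ℕ → Carrier
  stirlingSum G l = Σ< (suc l) (λ i → S₁ l i * ι (i !) * G i)

  atLog : Series → Series
  atLog G l = invFact l * stirlingSum G l

  S₁-above : ∀ n m → n < m → S₁ n m ≈ 0#
  S₁-above zero (suc m) p = refl
  S₁-above (suc n) (suc m) (s≤s p) = begin
    S₁ n m - ι n * S₁ n (suc m)
      ≈⟨ +-cong (S₁-above n m p) (-‿cong (*-congˡ (S₁-above n (suc m) (NP.m<n⇒m<1+n p)))) ⟩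
    0# - ι n * 0#   ≈⟨ solve 1 (λ x → :0 :- x :* :0 := :0) refl _ ⟩
    0#              ∎

  ι*S₁-zero : ∀ l → ι l * S₁ l 0 ≈ 0#
  ι*S₁-zero zero = zeroˡ _
  ι*S₁-zero (suc l) = zeroʳ _

  atLog-cong : ∀ {G H} → G ≈S H → atLog G ≈S atLog H
  atLog-cong e l = *-congˡ (Σ-cong (suc l) (λ i → *-congˡ (e i)))

  atLog-+ : ∀ G H → atLog (G +S H) ≈S atLog G +S atLog H
  atLog-+ G H l = trans (*-congˡ (trans (Σ-cong (suc l) (λ i → distribˡ _ _ _)) (Σ-+ (suc l) _ _))) (distribˡ _ _ _)

  atLog-⋅ : ∀ a G → atLog (a ⋅ G) ≈S a ⋅ atLog G
  atLog-⋅ a G l = begin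
    invFact l * Σ< (suc l) (λ i → S₁ l i * ι (i !) * (a * G i))
      ≈⟨ *-congˡ (Σ-cong (suc l) (λ i → solve 3 (λ x a g → x :* (a :* g) := a :* (x :* g)) refl _ _ _)) ⟩
    invFact l * Σ< (suc l) (λ i → a * (S₁ l i * ι (i !) * G i)) ≈⟨ *-congˡ (Σ-*ˡ (suc l) a _) ⟨
    invFact l * (a * stirlingSum G l)
      ≈⟨ solve 3 (λ x a g → x :* (a :* g) := a :* (x :* g)) refl _ _ _ ⟩
    a * atLog G l ∎

  atLog-neg : ∀ G → atLog (-S G) ≈S -S atLog G
  atLog-neg G l = trans (*-congˡ (trans (Σ-cong (suc l) (λ i → sym (-‿distribʳ-* _ _))) (Σ-neg (suc l) _)))
    (sym (-‿distribʳ-* _ _))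

  atLog-sub : ∀ G H → atLog (G -S H) ≈S atLog G -S atLog H
  atLog-sub G H = transS (atLog-+ G (-S H)) (λ l → +-congˡ (atLog-neg H l))

  -- ln(1+0) = 0, so the constant term is kept
  atLog-0 : ∀ G → atLog G 0 ≈ G 0
  atLog-0 G = solve 1 (λ g → :1 :* (:0 :+ :1 :* (:1 :+ :0) :* g) := g) refl _

  atLog-one : atLog oneS ≈S oneS
  atLog-one zero = atLog-0 oneS
  atLog-one (suc l) = begin
    invFact (suc l) * stirlingSum oneS (suc l)  ≈⟨ *-congˡ (Σ-first (suc l) _) ⟩
    invFact (suc l) * (0# * ι 1 * 1# + Σ< (suc l) (λ i → S₁ (suc l) (suc i) * ι (suc i !) * 0#))
      ≈⟨ *-congˡ (+-cong (trans (*-assoc _ _ _) (zeroˡ _)) (trans (Σ-cong (suc l) (λ i → zeroʳ _)) (Σ-0 (suc l)))) ⟩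
    invFact (suc l) * (0# + 0#)                 ≈⟨ trans (*-congˡ (+-identityˡ _)) (zeroʳ _) ⟩
    0#                                          ∎

  -- l · stirlingSum G l, reindexed by i ↦ i+1 (the terms i = 0 and i = l+1 vanish)
  ι*stirlingSum : ∀ G l → ι l * stirlingSum G l ≈ Σ< (suc l) (λ i → ι l * (S₁ l (suc i) * ι (suc i !) * G (suc i)))
  ι*stirlingSum G l = begin
    ι l * Σ< (suc l) w                          ≈⟨ *-congˡ (+-identityʳ _) ⟨
    ι l * (Σ< (suc l) w + 0#)                   ≈⟨ *-congˡ (+-congˡ w-top) ⟨
    ι l * Σ< (suc (suc l)) w                    ≈⟨ *-congˡ (Σ-first (suc l) w) ⟩
    ι l * (w 0 + Σ< (suc l) (λ i → w (suc i)))  ≈⟨ distribˡ _ _ _ ⟩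
    ι l * w 0 + ι l * Σ< (suc l) (λ i → w (suc i))
      ≈⟨ +-cong w-bottom (Σ-*ˡ (suc l) _ _) ⟩
    0# + Σ< (suc l) (λ i → ι l * w (suc i))     ≈⟨ +-identityˡ _ ⟩
    Σ< (suc l) (λ i → ι l * w (suc i))          ∎
    where
    w : ℕ → Carrier
    w i = S₁ l i * ι (i !) * G i
    w-top : w (suc l) ≈ 0#
    w-top = trans (*-congʳ (*-congʳ (S₁-above l (suc l) NP.≤-refl))) (trans (*-assoc _ _ _) (zeroˡ _))
    w-bottom : ι l * w 0 ≈ 0#
    w-bottom = trans (solve 4 (λ a s x g → a :* (s :* x :* g) := (a :* s) :* (x :* g)) refl _ _ _ _)
                     (trans (*-congʳ (ι*S₁-zero l)) (zeroˡ _))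

  -- the Stirling recurrence S₁(l+1,i+1) = S₁(l,i) - l S₁(l,i+1) at the level of stirlingSum
  stirlingSum-recurrence : ∀ G l →
    stirlingSum G (suc l) + ι l * stirlingSum G l ≈ Σ< (suc l) (λ i → S₁ l i * ι (i !) * (ι (suc i) * G (suc i)))
  stirlingSum-recurrence G l = begin
    stirlingSum G (suc l) + ι l * stirlingSum G l
      ≈⟨ +-cong (Σ-first (suc l) _) (ι*stirlingSum G l) ⟩
    (0# * ι 1 * G 0 + Σ< (suc l) v) + Σ< (suc l) (λ i → ι l * (S₁ l (suc i) * ι (suc i !) * G (suc i)))
      ≈⟨ +-congʳ (trans (+-congʳ (trans (*-assoc _ _ _) (zeroˡ _))) (+-identityˡ _)) ⟩
    Σ< (suc l) v + Σ< (suc l) (λ i → ι l * (S₁ l (suc i) * ι (suc i !) * G (suc i)))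
      ≈⟨ Σ-+ (suc l) _ _ ⟨
    Σ< (suc l) (λ i → v i + ι l * (S₁ l (suc i) * ι (suc i !) * G (suc i)))
      ≈⟨ Σ-cong (suc l) term ⟩
    Σ< (suc l) (λ i → S₁ l i * ι (i !) * (ι (suc i) * G (suc i))) ∎
    where
    v : ℕ → Carrier
    v i = S₁ (suc l) (suc i) * ι (suc i !) * G (suc i)
    term : ∀ i → v i + ι l * (S₁ l (suc i) * ι (suc i !) * G (suc i)) ≈ S₁ l i * ι (i !) * (ι (suc i) * G (suc i))
    term i = begin
      (S₁ l i - ι l * S₁ l (suc i)) * ι (suc i !) * G (suc i) + ι l * (S₁ l (suc i) * ι (suc i !) * G (suc i))
        ≈⟨ solve 5 (λ a b c x g → (a :- b :* c) :* x :* g :+ b :* (c :* x :* g) := a :* x :* g) refl _ _ _ _ _ ⟩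
      S₁ l i * ι (suc i !) * G (suc i)               ≈⟨ *-congʳ (*-congˡ (ι-suc! i)) ⟩
      S₁ l i * (ι (suc i) * ι (i !)) * G (suc i)
        ≈⟨ solve 4 (λ a b c g → a :* (b :* c) :* g := a :* c :* (b :* g)) refl _ _ _ _ ⟩
      S₁ l i * ι (i !) * (ι (suc i) * G (suc i))     ∎

  -- chain rule: (1+t) d/dt G(ln(1+t)) = G'(ln(1+t))
  θ-atLog : ∀ G → θ (atLog G) ≈S atLog (∂ G)
  θ-atLog G l = begin
    ι (suc l) * (invFact (suc l) * stirlingSum G (suc l)) + ι l * (invFact l * stirlingSum G l)
      ≈⟨ +-congʳ (trans (sym (*-assoc _ _ _)) (*-congʳ (ι-invFact-suc l))) ⟩
    invFact l * stirlingSum G (suc l) + ι l * (invFact l * stirlingSum G l)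
      ≈⟨ solve 4 (λ f a b x → f :* a :+ b :* (f :* x) := f :* (a :+ b :* x)) refl _ _ _ _ ⟩
    invFact l * (stirlingSum G (suc l) + ι l * stirlingSum G l) ≈⟨ *-congˡ (stirlingSum-recurrence G l) ⟩
    atLog (∂ G) l ∎

  -- multiplicativity, by induction on the order l simultaneously for all G, H:
  -- θ of both sides agree at order l by the chain and Leibniz rules
  atLog-·S : ∀ G H → atLog (G ·S H) ≈S atLog G ·S atLog H
  atLog-·S G H zero = trans (atLog-0 (G ·S H)) (+-congˡ (*-cong (sym (atLog-0 G)) (sym (atLog-0 H))))
  atLog-·S G H (suc l) = θ-step (atLog (G ·S H)) (atLog G ·S atLog H) l θ-agree (atLog-·S G H l)
    where
    θ-agree : θ (atLog (G ·S H)) l ≈ θ (atLog G ·S atLog H) l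
    θ-agree = begin
      θ (atLog (G ·S H)) l                        ≈⟨ θ-atLog (G ·S H) l ⟩
      atLog (∂ (G ·S H)) l                        ≈⟨ atLog-cong (∂-Leibniz G H) l ⟩
      atLog (∂ G ·S H +S G ·S ∂ H) l              ≈⟨ atLog-+ _ _ l ⟩
      atLog (∂ G ·S H) l + atLog (G ·S ∂ H) l     ≈⟨ +-cong (atLog-·S (∂ G) H l) (atLog-·S G (∂ H) l) ⟩
      (atLog (∂ G) ·S atLog H) l + (atLog G ·S atLog (∂ H)) l
        ≈⟨ +-cong (·S-congˡ (atLog H) (symS (θ-atLog G)) l) (·S-congʳ (atLog G) (symS (θ-atLog H)) l) ⟩
      (θ (atLog G) ·S atLog H) l + (atLog G ·S θ (atLog H)) l ≈⟨ θ-Leibniz (atLog G) (atLog H) l ⟨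
      θ (atLog G ·S atLog H) l                    ∎

module ExponentialSeries {c ℓ} (F : Char0Field c ℓ) where
  open import Data.Nat as ℕ using (ℕ; zero; suc; _∸_; _≤_)
  import Data.Nat.Properties as NP
  import Relation.Binary.PropositionalEquality as P
  open Char0Field F
  open Daehee F
  open Arithmetic F
  open FiniteSums F
  open PowerSeries F
  open Derivations F
  open Factorials F
  open AtLog F

  ^-cong : ∀ {x y} n → x ≈ y → x ^ n ≈ y ^ n
  ^-cong zero e = refl
  ^-cong (suc n) e = *-cong e (^-cong n e)

  ^-+ : ∀ x m n → x ^ (m ℕ.+ n) ≈ x ^ m * x ^ n
  ^-+ x zero n = sym (*-identityˡ _)
  ^-+ x (suc m) n = trans (*-congˡ (^-+ x m n)) (sym (*-assoc _ _ _))

  expS : Carrier → Series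
  expS y n = y ^ n * invFact n

  expS-cong : ∀ {y z} → y ≈ z → expS y ≈S expS z
  expS-cong e n = *-congʳ (^-cong n e)

  expS-zero : expS 0# ≈S oneS
  expS-zero zero = *-identityˡ _
  expS-zero (suc n) = trans (*-assoc _ _ _) (zeroˡ _)

  ∂-expS : ∀ y → ∂ (expS y) ≈S y ⋅ expS y
  ∂-expS y n = begin
    ι (suc n) * (y * y ^ n * invFact (suc n))
      ≈⟨ solve 4 (λ i y p f → i :* (y :* p :* f) := y :* (p :* (i :* f))) refl _ _ _ _ ⟩
    y * (y ^ n * (ι (suc n) * invFact (suc n)))  ≈⟨ *-congˡ (*-congˡ (ι-invFact-suc n)) ⟩
    y * (y ^ n * invFact n)                      ∎

  -- e^{ys} e^{zs} = e^{(y+z)s}: both sides solve ∂X = (y+z)X with X(0) = 1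
  expS-+ : ∀ y z → expS y ·S expS z ≈S expS (y + z)
  expS-+ y z = ∂-eigen-unique (y + z) _ _ ∂-product (∂-expS (y + z))
      (solve 2 (λ y z → :0 :+ (:1 :* :1) :* (:1 :* :1) := :1 :* :1) refl y z)
    where
    ∂-product : ∂ (expS y ·S expS z) ≈S (y + z) ⋅ (expS y ·S expS z)
    ∂-product n = begin
      ∂ (expS y ·S expS z) n                              ≈⟨ ∂-Leibniz (expS y) (expS z) n ⟩
      (∂ (expS y) ·S expS z) n + (expS y ·S ∂ (expS z)) n
        ≈⟨ +-cong (·S-congˡ (expS z) (∂-expS y) n) (·S-congʳ (expS y) (∂-expS z) n) ⟩
      ((y ⋅ expS y) ·S expS z) n + (expS y ·S (z ⋅ expS z)) n
        ≈⟨ +-cong (·S-⋅ˡ y (expS y) (expS z) n) (·S-⋅ʳ z (expS y) (expS z) n) ⟩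
      y * (expS y ·S expS z) n + z * (expS y ·S expS z) n  ≈⟨ distribʳ _ _ _ ⟨
      (y + z) * (expS y ·S expS z) n                       ∎

  θ-binomS : ∀ y → θ (binomS y) ≈S y ⋅ binomS y
  θ-binomS y n = begin
    ι (suc n) * (falling y n * (y - ι n) * invFact (suc n)) + ι n * (falling y n * invFact n)
      ≈⟨ +-congʳ (solve 4 (λ i p q f → i :* (p :* q :* f) := p :* q :* (i :* f)) refl _ _ _ _) ⟩
    falling y n * (y - ι n) * (ι (suc n) * invFact (suc n)) + ι n * (falling y n * invFact n)
      ≈⟨ +-congʳ (*-congˡ (ι-invFact-suc n)) ⟩
    falling y n * (y - ι n) * invFact n + ι n * (falling y n * invFact n)
      ≈⟨ solve 4 (λ p y i f → p :* (y :- i) :* f :+ i :* (p :* f) := y :* (p :* f)) refl _ _ _ _ ⟩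
    y * (falling y n * invFact n) ∎

  atLog-expS : ∀ y → atLog (expS y) ≈S binomS y
  atLog-expS y = θ-eigen-unique y _ _
    (transS (θ-atLog (expS y)) (transS (atLog-cong (∂-expS y)) (atLog-⋅ y (expS y))))
    (θ-binomS y) (atLog-0 (expS y))

  binomS-zero : binomS 0# ≈S oneS
  binomS-zero = transS (symS (atLog-expS 0#)) (transS (atLog-cong expS-zero) atLog-one)

  falling-shift : ∀ y n → falling y (suc n) ≈ y * falling (y - 1#) n
  falling-shift y zero = solve 1 (λ y → :1 :* (y :- :0) := y :* :1) refl y
  falling-shift y (suc n) = begin
    falling y (suc n) * (y - (1# + ι n))          ≈⟨ *-congʳ (falling-shift y n) ⟩
    y * falling (y - 1#) n * (y - (1# + ι n))
      ≈⟨ solve 4 (λ y p o i → y :* p :* (y :- (o :+ i)) := y :* (p :* (y :- o :- i))) refl _ _ _ _ ⟩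
    y * (falling (y - 1#) n * (y - 1# - ι n))     ∎

  ∂-binomS : ∀ y → ∂ (binomS y) ≈S y ⋅ binomS (y - 1#)
  ∂-binomS y n = begin
    ι (suc n) * (falling y (suc n) * invFact (suc n))
      ≈⟨ solve 3 (λ i p f → i :* (p :* f) := p :* (i :* f)) refl _ _ _ ⟩
    falling y (suc n) * (ι (suc n) * invFact (suc n))  ≈⟨ *-cong (falling-shift y n) (ι-invFact-suc n) ⟩
    y * falling (y - 1#) n * invFact n                  ≈⟨ *-assoc _ _ _ ⟩
    y * (falling (y - 1#) n * invFact n)                ∎

  onePlusT : Series
  onePlusT = oneS +S tS

  onePlusT-·S : ∀ f → onePlusT ·S f ≈S f +S shift f
  onePlusT-·S f n = trans (·S-distribʳ f oneS tS n)
    (+-cong (oneS-identityˡ f n) (symS (shift-as-product f) n))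

  θ-as-product : ∀ f → θ f ≈S onePlusT ·S ∂ f
  θ-as-product f n = trans (+-congˡ (sym (shift-∂ f n))) (sym (onePlusT-·S (∂ f) n))

  binomS-pascal : ∀ y → binomS y ≈S onePlusT ·S binomS (y - 1#)
  binomS-pascal y = transS pascal (symS (onePlusT-·S (binomS (y - 1#))))
    where
    pascal : binomS y ≈S binomS (y - 1#) +S shift (binomS (y - 1#))
    pascal zero = sym (+-identityʳ _)
    pascal (suc m) = begin
      falling y (suc m) * invFact (suc m)       ≈⟨ *-congʳ (falling-shift y m) ⟩
      y * Fm * invFact (suc m)
        ≈⟨ solve 4 (λ y p i j → y :* p :* i := p :* (y :- :1 :- j) :* i :+ p :* ((:1 :+ j) :* i)) refl y Fm (invFact (suc m)) (ι m) ⟩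
      Fm * (y - 1# - ι m) * invFact (suc m) + Fm * (ι (suc m) * invFact (suc m))
        ≈⟨ +-congˡ (*-congˡ (ι-invFact-suc m)) ⟩
      binomS (y - 1#) (suc m) + binomS (y - 1#) m ∎
      where
      Fm : Carrier
      Fm = falling (y - 1#) m

  scale : Carrier → Series → Series
  scale b G n = b ^ n * G n

  scale-cong : ∀ b {G H} → G ≈S H → scale b G ≈S scale b H
  scale-cong b e n = *-congˡ (e n)

  scale-one : ∀ b → scale b oneS ≈S oneS
  scale-one b zero = *-identityˡ _
  scale-one b (suc n) = zeroʳ _

  scale-·S : ∀ b G H → scale b (G ·S H) ≈S scale b G ·S scale b H
  scale-·S b G H n = begin
    b ^ n * Σ< (suc n) (λ k → G k * H (n ∸ k))         ≈⟨ Σ-*ˡ (suc n) _ _ ⟩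
    Σ< (suc n) (λ k → b ^ n * (G k * H (n ∸ k)))       ≈⟨ Σ-cong< (suc n) (λ k k< → term k (NP.≤-pred k<)) ⟩
    Σ< (suc n) (λ k → b ^ k * G k * (b ^ (n ∸ k) * H (n ∸ k))) ∎
    where
    term : ∀ k → k ≤ n → b ^ n * (G k * H (n ∸ k)) ≈ b ^ k * G k * (b ^ (n ∸ k) * H (n ∸ k))
    term k k≤ = trans (*-congʳ (trans (reflexive (P.cong (b ^_) (P.sym (NP.m+[n∸m]≡n k≤)))) (^-+ b k (n ∸ k))))
      (solve 4 (λ p q g h → p :* q :* (g :* h) := p :* g :* (q :* h)) refl _ _ _ _)

-- With β(s) = s/(e^s - 1),
-- φ(s) = s/(e^{as} - 1) = β(as)/a and C₀(s) = (β(-as) - 1)/s one has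
--     φ' = - φ C₀ .
-- Everything is proved without division: q(s) = (e^{as} - 1)/s is the
-- inverse of φ, and q C₀ = q' follows after multiplying by s from
-- q β(-as) = a e^{as} and s q' = a e^{as} - q.
module BernoulliIdentity {c ℓ} (F : Char0Field c ℓ) (a : Char0Field.Carrier F)
                         (a≠0 : ¬ (Char0Field._≈_ F a (Char0Field.0# F))) where
  open import Data.Nat using (zero; suc)
  open Char0Field F
  open Daehee F
  open Arithmetic F
  open PowerSeries F
  open SeriesSolver
  open Derivations F
  open SeriesInverse F
  open ExponentialSeries F

  -- ε(s) = (e^s - 1)/s and β = 1/ε, whose coefficients are B_n / n!
  ε β : Series
  ε = expmOverT₁
  β = invS ε 1#

  inv1+-zero : inv1+ 0 ≈ 1#
  inv1+-zero = trans (sym (trans (*-congˡ (+-identityʳ 1#)) (*-identityʳ _))) (inv1+-inverseˡ 0)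

  ε·β : ε ·S β ≈S oneS
  ε·β = invS-inverse ε 1# (trans (*-identityʳ _) (trans (*-identityʳ _) inv1+-zero))

  shift-expm : ∀ b → shift (b ⋅ scale b ε) ≈S expS b -S oneS
  shift-expm b zero = solve 0 (:0 := :1 :* :1 :- :1) refl
  shift-expm b (suc n) = solve 3 (λ b p f → b :* (p :* f) := b :* p :* f :- :0) refl b (b ^ n) (invFact (suc n))

  expm·β : ∀ b → (b ⋅ scale b ε) ·S scale b β ≈S b ⋅ oneS
  expm·β b = transS (·S-⋅ˡ b (scale b ε) (scale b β))
    (λ n → *-congˡ (transS (symS (scale-·S b ε β)) (transS (scale-cong b ε·β) (scale-one b)) n))

  -- q(s) = (e^{as} - 1)/s, φ(s) = s/(e^{as} - 1) = β(as)/a, and β₋(s) = β(-as)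
  q φ β₋ : Series
  q = a ⋅ scale a ε
  φ = a ⁻¹⟨ a≠0 ⟩ ⋅ scale a β
  β₋ = scale (- a) β

  φ·q : φ ·S q ≈S oneS
  φ·q = transS (·S-comm φ q) (transS (·S-⋅ʳ _ q (scale a β)) (λ n → begin
    a ⁻¹⟨ a≠0 ⟩ * (q ·S scale a β) n  ≈⟨ *-congˡ (expm·β a n) ⟩
    a ⁻¹⟨ a≠0 ⟩ * (a * oneS n)        ≈⟨ trans (sym (*-assoc _ _ _)) (*-congʳ (trans (*-comm _ _) (inverseʳ a a≠0))) ⟩
    1# * oneS n                        ≈⟨ *-identityˡ _ ⟩
    oneS n                             ∎))

  expm₋·β₋ : (expS (- a) -S oneS) ·S β₋ ≈S ((- a) ⋅ oneS) ·S tS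
  expm₋·β₋ = transS (·S-congˡ β₋ (transS (symS (shift-expm (- a))) (shift-as-product _)))
    (transS (·S-assoc tS _ β₋) (transS (·S-congʳ tS (expm·β (- a))) (·S-comm tS _)))

  expS-inverse : expS a ·S expS (- a) ≈S oneS
  expS-inverse = transS (expS-+ a (- a)) (transS (expS-cong (-‿inverseʳ a)) expS-zero)

  -- q β(-as) = a e^{as}, checked after multiplication by s
  q·β₋ : q ·S β₋ ≈S (a ⋅ oneS) ·S expS a
  q·β₋ = tS-cancel (from-difference-zero (transS identity (transS
      (SR.+-cong (SR.+-cong (SR.+-cong (SR.*-cong (difference-zero tq) (reflS {β₋}))
                                       (SR.-‿cong (SR.*-cong (reflS {E}) (difference-zero expm₋·β₋))))
                            (SR.*-cong (difference-zero expS-inverse) (reflS {β₋})))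
                 (SR.-‿cong (SR.*-cong (reflS {tS ·S E}) a-a)))
      (solveS 4 (λ S B E N → ⊘ ⊗ B ⊖ E ⊗ ⊘ ⊕ ⊘ ⊗ B ⊖ S ⊗ E ⊗ ⊘ ≐ ⊘) reflS tS β₋ E (a ⋅ oneS)))))
    where
    E E₋ : Series
    E = expS a
    E₋ = expS (- a)
    tq : tS ·S q ≈S E -S oneS
    tq = transS (symS (shift-as-product q)) (shift-expm a)
    a-a : (a ⋅ oneS) +S ((- a) ⋅ oneS) ≈S zeroS
    a-a n = trans (sym (distribʳ _ _ _)) (trans (*-congʳ (-‿inverseʳ a)) (zeroˡ _))
    -- the difference of the two sides, written as a combination of the
    -- differences that vanish by tq, expm₋·β₋, expS-inverse and a-a
    identity : tS ·S (q ·S β₋) -S tS ·S ((a ⋅ oneS) ·S E)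
            ≈S ((tS ·S q -S (E -S oneS)) ·S β₋ -S E ·S ((E₋ -S oneS) ·S β₋ -S ((- a) ⋅ oneS) ·S tS))
               +S (E ·S E₋ -S oneS) ·S β₋ -S (tS ·S E) ·S ((a ⋅ oneS) +S ((- a) ⋅ oneS))
    identity = solveS 7 (λ S Q B E E₋ N M →
        S ⊗ (Q ⊗ B) ⊖ S ⊗ (N ⊗ E)
      ≐ ((S ⊗ Q ⊖ (E ⊖ ①)) ⊗ B ⊖ E ⊗ ((E₋ ⊖ ①) ⊗ B ⊖ M ⊗ S)) ⊕ (E ⊗ E₋ ⊖ ①) ⊗ B ⊖ (S ⊗ E) ⊗ (N ⊕ M))
      reflS tS q β₋ E E₋ (a ⋅ oneS) ((- a) ⋅ oneS)

  -- C₀(s) = (β(-as) - 1)/s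
  bernoulliTail : Series
  bernoulliTail k = (- a) ^ (suc k) * β (suc k)

  shift-bernoulliTail : shift bernoulliTail ≈S β₋ -S oneS
  shift-bernoulliTail zero = solve 0 (:0 := :1 :* :1 :- :1) refl
  shift-bernoulliTail (suc k) = sym (trans (+-congˡ -0#≈0#) (+-identityʳ _))

  -- s q' = a e^{as} - q, from q + s q' = (s q)' = (e^{as} - 1)' = a e^{as}
  t∂q : t∂ q ≈S (a ⋅ oneS) ·S expS a -S q
  t∂q = from-difference-zero (transS
    (λ n → solve 3 (λ x q e → x :- (e :- q) := (q :+ x) :- e) refl (t∂ q n) (q n) (((a ⋅ oneS) ·S expS a) n))
    (difference-zero ∂[tq]))
    where
    ∂[tq] : q +S t∂ q ≈S (a ⋅ oneS) ·S expS a
    ∂[tq] = transS (symS (∂-shift q)) (transS (∂-cong (shift-expm a))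
      (transS (λ n → *-congˡ (trans (+-congˡ -0#≈0#) (+-identityʳ _)))
      (transS (∂-expS a) (⋅-as-product a (expS a)))))

  -- q C₀ = q', checked after multiplication by s
  q·C₀ : q ·S bernoulliTail ≈S ∂ q
  q·C₀ = tS-cancel λ n → begin
    (tS ·S (q ·S bernoulliTail)) n    ≈⟨ solveS 3 (λ S Q C → S ⊗ (Q ⊗ C) ≐ Q ⊗ (S ⊗ C)) reflS tS q bernoulliTail n ⟩
    (q ·S (tS ·S bernoulliTail)) n
      ≈⟨ ·S-congʳ q (transS (symS (shift-as-product bernoulliTail)) shift-bernoulliTail) n ⟩
    (q ·S (β₋ -S oneS)) n             ≈⟨ solveS 2 (λ Q B → Q ⊗ (B ⊖ ①) ≐ Q ⊗ B ⊖ Q) reflS q β₋ n ⟩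
    (q ·S β₋) n - q n                 ≈⟨ +-congʳ (q·β₋ n) ⟩
    ((a ⋅ oneS) ·S expS a) n - q n    ≈⟨ t∂q n ⟨
    t∂ q n                            ≈⟨ shift-∂ q n ⟨
    shift (∂ q) n                     ≈⟨ shift-as-product (∂ q) n ⟩
    (tS ·S ∂ q) n                     ∎

  -- the Bernoulli identity φ' = - φ C₀; its difference is a combination of
  -- φ q - 1, (φ q)' and q C₀ - q'
  ∂φ : ∂ φ ≈S -S (φ ·S bernoulliTail)
  ∂φ = from-difference-zero (transS
    (solveS 5 (λ D φ q C G → D ⊖ ⊝ (φ ⊗ C) ≐ φ ⊗ (D ⊗ q ⊕ φ ⊗ G) ⊕ φ ⊗ φ ⊗ (q ⊗ C ⊖ G) ⊖ (D ⊕ φ ⊗ C) ⊗ (φ ⊗ q ⊖ ①))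
       reflS (∂ φ) φ q bernoulliTail (∂ q))
    (transS (SR.+-cong (SR.+-cong (SR.*-cong (reflS {φ}) ∂[φq]) (SR.*-cong (reflS {φ ·S φ}) (difference-zero q·C₀)))
                       (SR.-‿cong (SR.*-cong (reflS {∂ φ +S φ ·S bernoulliTail}) (difference-zero φ·q))))
      (solveS 3 (λ φ Φ T → φ ⊗ ⊘ ⊕ Φ ⊗ ⊘ ⊖ T ⊗ ⊘ ≐ ⊘) reflS φ (φ ·S φ) (∂ φ +S φ ·S bernoulliTail))))
    where
    ∂[φq] : ∂ φ ·S q +S φ ·S ∂ q ≈S zeroS
    ∂[φq] = transS (symS (∂-Leibniz φ q)) (transS (∂-cong φ·q) ∂-one)

-- ln(1+t) = t · logOverT is the substitution s = ln(1+t) applied to s itself: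
-- both sides satisfy θ X = 1 and vanish at t = 0.
module Logarithm {c ℓ} (F : Char0Field c ℓ) where
  open import Data.Nat using (zero; suc)
  open Char0Field F
  open Daehee F
  open Arithmetic F
  open PowerSeries F
  open Derivations F
  open AtLog F

  θ-log : θ (shift logOverT) ≈S oneS
  θ-log zero = trans (solve 2 (λ i v → i :* (:1 :* v) :+ :0 :* :0 := i :* v) refl (ι 1) (inv1+ 0)) (inv1+-inverseʳ 0)
  θ-log (suc m) = begin
    ι (suc (suc m)) * ((- 1#) * (- 1#) ^ m * inv1+ (suc m)) + ι (suc m) * ((- 1#) ^ m * inv1+ m)
      ≈⟨ solve 5 (λ i j s v w → i :* ((:- :1) :* s :* v) :+ j :* (s :* w) := (:- :1) :* s :* (i :* v) :+ s :* (j :* w)) refl _ _ _ _ _ ⟩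
    (- 1#) * (- 1#) ^ m * (ι (suc (suc m)) * inv1+ (suc m)) + (- 1#) ^ m * (ι (suc m) * inv1+ m)
      ≈⟨ +-cong (*-congˡ (inv1+-inverseʳ (suc m))) (*-congˡ (inv1+-inverseʳ m)) ⟩
    (- 1#) * (- 1#) ^ m * 1# + (- 1#) ^ m * 1#  ≈⟨ solve 1 (λ s → (:- :1) :* s :* :1 :+ s :* :1 := :0) refl _ ⟩
    0#                                          ∎

  ∂-tS : ∂ tS ≈S oneS
  ∂-tS zero = trans (*-identityʳ _) (+-identityʳ _)
  ∂-tS (suc n) = zeroʳ _

  log≈atLog-tS : shift logOverT ≈S atLog tS
  log≈atLog-tS = θ-unique _ _
    (λ l _ → trans (θ-log l) (sym (trans (θ-atLog tS l) (trans (atLog-cong ∂-tS l) (atLog-one l)))))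
    (sym (atLog-0 tS))

-- Series satisfying  θ g = g M  (M is (1+t) g'/g, the logarithmic θ-derivative).
module LogarithmicDerivative {c ℓ} (F : Char0Field c ℓ) where
  open import Data.Nat using (ℕ; zero; suc)
  open import Data.Fin as Fin using (Fin)
  open Char0Field F
  open Daehee F
  open Arithmetic F
  open FiniteSums F
  open PowerSeries F
  open SeriesSolver
  open Derivations F
  open ExponentialSeries F

  HasLogDerivative : Series → Series → Set ℓ
  HasLogDerivative g M = θ g ≈S g ·S M

  logDerivative-·S : ∀ {g h M N} → HasLogDerivative g M → HasLogDerivative h N → HasLogDerivative (g ·S h) (M +S N)
  logDerivative-·S {g} {h} {M} {N} eg eh = transS (θ-Leibniz g h) (transS
    (SR.+-cong (·S-congˡ h eg) (·S-congʳ g eh))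
    (solveS 4 (λ g h M N → g ⊗ M ⊗ h ⊕ g ⊗ (h ⊗ N) ≐ g ⊗ h ⊗ (M ⊕ N)) reflS g h M N))

  ΣS : (r : ℕ) → (Fin r → Series) → Series
  ΣS r fs n = ΣFin r (λ j → fs j n)

  logDerivative-ΠS : ∀ r (gs Ms : Fin r → Series) → (∀ j → HasLogDerivative (gs j) (Ms j)) →
    HasLogDerivative (ΠS r gs) (ΣS r Ms)
  logDerivative-ΠS zero gs Ms e = transS θ-one (symS (oneS-identityˡ zeroS))
  logDerivative-ΠS (suc r) gs Ms e = logDerivative-·S {M = Ms Fin.zero} {N = ΣS r (λ j → Ms (Fin.suc j))} (e Fin.zero)
    (logDerivative-ΠS r (λ j → gs (Fin.suc j)) (λ j → Ms (Fin.suc j)) (λ j → e (Fin.suc j)))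

  ΣS-·S : ∀ r (fs : Fin r → Series) g → ΣS r fs ·S g ≈S ΣS r (λ j → fs j ·S g)
  ΣS-·S zero fs g n = trans (Σ-cong (suc n) (λ k → zeroˡ _)) (Σ-0 (suc n))
  ΣS-·S (suc r) fs g = transS (·S-distribʳ g (fs Fin.zero) (ΣS r (λ j → fs (Fin.suc j))))
    (SR.+-cong (reflS {fs Fin.zero ·S g}) (ΣS-·S r (λ j → fs (Fin.suc j)) g))

  ΣS-split : ∀ r (cs : Fin r → Carrier) (Λs : Fin r → Series) →
    ΣS r (λ j → cs j ⋅ oneS -S Λs j) ≈S ΣFin r cs ⋅ oneS -S ΣS r Λs
  ΣS-split zero cs Λs n = sym (trans (+-cong (zeroˡ _) -0#≈0#) (+-identityʳ _))
  ΣS-split (suc r) cs Λs n = trans (+-congˡ (ΣS-split r (λ j → cs (Fin.suc j)) (λ j → Λs (Fin.suc j)) n))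
    (solve 5 (λ c C o l L → (c :* o :- l) :+ (C :* o :- L) := (c :+ C) :* o :- (l :+ L)) refl _ _ _ _ _)

  ∂-generatingFunction : ∀ P c Λ x → HasLogDerivative P (c ⋅ oneS -S Λ) →
    ∂ (P ·S binomS x) ≈S (x + c) ⋅ (P ·S binomS (x - 1#)) -S P ·S (Λ ·S binomS (x - 1#))
  ∂-generatingFunction P c Λ x eP n = begin
    ∂ (P ·S binomS x) n                               ≈⟨ ∂-Leibniz P (binomS x) n ⟩
    (∂ P ·S binomS x) n + (P ·S ∂ (binomS x)) n
      ≈⟨ +-cong (·S-congʳ (∂ P) (binomS-pascal x) n) (·S-congʳ P (∂-binomS x) n) ⟩
    (∂ P ·S (onePlusT ·S B₋)) n + (P ·S (x ⋅ B₋)) n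
      ≈⟨ +-cong (solveS 3 (λ D U B → D ⊗ (U ⊗ B) ≐ U ⊗ D ⊗ B) reflS (∂ P) onePlusT B₋ n)
                (·S-congʳ P (⋅-as-product x B₋) n) ⟩
    ((onePlusT ·S ∂ P) ·S B₋) n + (P ·S (x1 ·S B₋)) n
      ≈⟨ +-congʳ (·S-congˡ B₋ (transS (symS (θ-as-product P)) eP) n) ⟩
    ((P ·S (c1 -S Λ)) ·S B₋) n + (P ·S (x1 ·S B₋)) n
      ≈⟨ solveS 5 (λ P c Λ B x → P ⊗ (c ⊖ Λ) ⊗ B ⊕ P ⊗ (x ⊗ B) ≐ (x ⊕ c) ⊗ (P ⊗ B) ⊖ P ⊗ (Λ ⊗ B))
           reflS P c1 Λ B₋ x1 n ⟩
    ((x1 +S c1) ·S (P ·S B₋)) n - (P ·S (Λ ·S B₋)) n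
      ≈⟨ +-congʳ (trans (·S-congˡ (P ·S B₋) (λ k → sym (distribʳ (oneS k) x c)) n) (sym (⋅-as-product (x + c) (P ·S B₋) n))) ⟩
    (x + c) * (P ·S B₋) n - (P ·S (Λ ·S B₋)) n      ∎
    where
    B₋ x1 c1 : Series
    B₋ = binomS (x - 1#)
    x1 = x ⋅ oneS
    c1 = c ⋅ oneS

-- The factor  f(t) = ln(1+t) / ((1+t)^a - 1)  of the generating functions is
-- φ(ln(1+t)); by the chain rule and the Bernoulli identity its logarithmic
-- θ-derivative is -Λ with Λ = C₀(ln(1+t)).  For the second kind the extra
-- factor (1+t)^a contributes the constant a.
module DaeheeFactor {c ℓ} (F : Char0Field c ℓ) (a : Char0Field.Carrier F)
                    (a≠0 : ¬ (Char0Field._≈_ F a (Char0Field.0# F))) where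
  open import Data.Nat using (zero; suc)
  open Char0Field F
  open Daehee F
  open Arithmetic F
  open PowerSeries F
  open SeriesSolver
  open Derivations F
  open SeriesInverse F
  open AtLog F
  open ExponentialSeries F
  open BernoulliIdentity F a a≠0
  open Logarithm F
  open LogarithmicDerivative F

  Λ : Series
  Λ = atLog bernoulliTail

  -- ((1+t)^a - 1)/t has constant term a, so 1/a starts its reciprocal
  expmOverT-inverse : expmOverT a ·S invS (expmOverT a) (a ⁻¹⟨ a≠0 ⟩) ≈S oneS
  expmOverT-inverse = invS-inverse (expmOverT a) (a ⁻¹⟨ a≠0 ⟩) (begin
    1# * (a - 0#) * (inv1+ 0 * 1#) * a ⁻¹⟨ a≠0 ⟩  ≈⟨ *-congʳ (solve 2 (λ a i → :1 :* (a :- :0) :* (i :* :1) := a :* i) refl a (inv1+ 0)) ⟩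
    a * inv1+ 0 * a ⁻¹⟨ a≠0 ⟩                     ≈⟨ *-congʳ (trans (*-congˡ inv1+-zero) (*-identityʳ a)) ⟩
    a * a ⁻¹⟨ a≠0 ⟩                               ≈⟨ inverseʳ a a≠0 ⟩
    1#                                            ∎)

  shift-expmOverT : shift (expmOverT a) ≈S binomS a -S oneS
  shift-expmOverT zero = solve 0 (:0 := :1 :* :1 :- :1) refl
  shift-expmOverT (suc n) = solve 1 (λ x → x := x :- :0) refl (binomS a (suc n))

  -- φ(ln(1+t)) ((1+t)^a - 1)/t = ln(1+t)/t, checked after multiplication by t
  atLogφ·expmOverT : atLog φ ·S expmOverT a ≈S logOverT
  atLogφ·expmOverT = tS-cancel λ n → begin
    (tS ·S (atLog φ ·S expmOverT a)) n
      ≈⟨ solveS 3 (λ S P E → S ⊗ (P ⊗ E) ≐ P ⊗ (S ⊗ E)) reflS tS (atLog φ) (expmOverT a) n ⟩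
    (atLog φ ·S (tS ·S expmOverT a)) n
      ≈⟨ ·S-congʳ (atLog φ) (transS (symS (shift-as-product (expmOverT a))) shift-expmOverT) n ⟩
    (atLog φ ·S (binomS a -S oneS)) n
      ≈⟨ ·S-congʳ (atLog φ) (SR.+-cong (symS (atLog-expS a)) (SR.-‿cong (symS atLog-one))) n ⟩
    (atLog φ ·S (atLog (expS a) -S atLog oneS)) n
      ≈⟨ ·S-congʳ (atLog φ) (symS (atLog-sub (expS a) oneS)) n ⟩
    (atLog φ ·S atLog (expS a -S oneS)) n        ≈⟨ atLog-·S φ (expS a -S oneS) n ⟨
    atLog (φ ·S (expS a -S oneS)) n
      ≈⟨ atLog-cong (·S-congʳ φ (transS (symS (shift-expm a)) (shift-as-product q))) n ⟩
    atLog (φ ·S (tS ·S q)) n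
      ≈⟨ atLog-cong (solveS 3 (λ φ S q → φ ⊗ (S ⊗ q) ≐ S ⊗ (φ ⊗ q)) reflS φ tS q) n ⟩
    atLog (tS ·S (φ ·S q)) n                     ≈⟨ atLog-cong (transS (·S-congʳ tS φ·q) (oneS-identityʳ tS)) n ⟩
    atLog tS n                                   ≈⟨ log≈atLog-tS n ⟨
    shift logOverT n                             ≈⟨ shift-as-product logOverT n ⟩
    (tS ·S logOverT) n                           ∎

  -- the Daehee factor is φ(ln(1+t)): multiply the previous identity by 1/expmOverT
  daeheeFactor≈atLogφ : daeheeFactor a a≠0 ≈S atLog φ
  daeheeFactor≈atLogφ = transS (·S-congˡ u (symS atLogφ·expmOverT))
    (transS (·S-assoc (atLog φ) (expmOverT a) u) (transS (·S-congʳ (atLog φ) expmOverT-inverse) (oneS-identityʳ (atLog φ))))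
    where
    u : Series
    u = invS (expmOverT a) (a ⁻¹⟨ a≠0 ⟩)

  logDerivative-first : HasLogDerivative (daeheeFactor a a≠0) (0# ⋅ oneS -S Λ)
  logDerivative-first n = begin
    θ f n                                  ≈⟨ θ-cong daeheeFactor≈atLogφ n ⟩
    θ (atLog φ) n                          ≈⟨ θ-atLog φ n ⟩
    atLog (∂ φ) n                          ≈⟨ atLog-cong ∂φ n ⟩
    atLog (-S (φ ·S bernoulliTail)) n      ≈⟨ atLog-neg (φ ·S bernoulliTail) n ⟩
    - atLog (φ ·S bernoulliTail) n         ≈⟨ -‿cong (atLog-·S φ bernoulliTail n) ⟩
    - (atLog φ ·S Λ) n                     ≈⟨ -‿cong (·S-congˡ Λ daeheeFactor≈atLogφ n) ⟨
    - (f ·S Λ) n                           ≈⟨ solveS 2 (λ f Λ → ⊝ (f ⊗ Λ) ≐ f ⊗ (⊘ ⊖ Λ)) reflS f Λ n ⟩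
    (f ·S (zeroS -S Λ)) n                  ≈⟨ ·S-congʳ f (SR.+-cong (λ k → sym (zeroˡ (oneS k))) (reflS { -S Λ})) n ⟩
    (f ·S (0# ⋅ oneS -S Λ)) n              ∎
    where
    f : Series
    f = daeheeFactor a a≠0

  logDerivative-second : HasLogDerivative (binomS a ·S daeheeFactor a a≠0) (a ⋅ oneS -S Λ)
  logDerivative-second = transS
    (logDerivative-·S {M = a ⋅ oneS} {N = 0# ⋅ oneS -S Λ}
      (transS (θ-binomS a) (transS (⋅-as-product a (binomS a)) (·S-comm _ _))) logDerivative-first)
    (·S-congʳ _ (λ n → solve 3 (λ a o l → a :* o :+ (:0 :* o :- l) := a :* o :- l) refl a (oneS n) (Λ n)))

module CoefficientFormula {c ℓ} (F : Char0Field c ℓ) where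
  open import Data.Nat as ℕ using (ℕ; suc; _∸_; _≤_; _!)
  import Data.Nat.Properties as NP
  open import Data.Nat.Combinatorics using (_C_)
  open import Data.Fin using (Fin)
  import Relation.Binary.PropositionalEquality as P
  open Char0Field F
  open Daehee F
  open Arithmetic F
  open FiniteSums F
  open PowerSeries F
  open Factorials F
  open AtLog F
  open ExponentialSeries F
  open LogarithmicDerivative F using (ΣS)

  weight : Carrier → ℕ → ℕ → Carrier
  weight a m i = inv1+ i * ι (suc i C m) * B (suc i ∸ m) * (- a) ^ (suc i ∸ m)

  module _ (a : Carrier) (a≠0 : ¬ (a ≈ 0#)) (y : Carrier) where
    open BernoulliIdentity F a a≠0 using (β; bernoulliTail)

    tail·expS-coefficient : ∀ i → ι (i !) * (bernoulliTail ·S expS y) i ≈ Σ< (suc i) (λ m → weight a m i * y ^ m)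
    tail·expS-coefficient i = begin
      ι (i !) * (bernoulliTail ·S expS y) i                           ≈⟨ Σ-*ˡ (suc i) _ _ ⟩
      Σ< (suc i) (λ k → ι (i !) * (bernoulliTail k * expS y (i ∸ k))) ≈⟨ Σ-reverse i _ ⟩
      Σ< (suc i) (λ m → ι (i !) * (bernoulliTail (i ∸ m) * expS y (i ∸ (i ∸ m))))
        ≈⟨ Σ-cong< (suc i) (λ m m< → term m (NP.≤-pred m<)) ⟩
      Σ< (suc i) (λ m → weight a m i * y ^ m)                         ∎
      where
      term : ∀ m → m ≤ i → ι (i !) * (bernoulliTail (i ∸ m) * expS y (i ∸ (i ∸ m))) ≈ weight a m i * y ^ m
      term m m≤ = begin
        ι (i !) * (((- a) ^ (suc (i ∸ m)) * β (suc (i ∸ m))) * (y ^ (i ∸ (i ∸ m)) * invFact (i ∸ (i ∸ m))))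
          ≡⟨ P.cong₂ (λ u v → ι (i !) * (((- a) ^ u * β u) * (y ^ v * invFact v))) (P.sym (NP.+-∸-assoc 1 m≤)) (NP.m∸[m∸n]≡n m≤) ⟩
        ι (i !) * (((- a) ^ k * β k) * (y ^ m * invFact m))
          ≈⟨ solve 5 (λ f A b Y im → f :* ((A :* b) :* (Y :* im)) := (f :* im) :* b :* A :* Y) refl _ _ _ _ _ ⟩
        (ι (i !) * invFact m) * β k * (- a) ^ k * y ^ m
          ≈⟨ *-congʳ (*-congʳ (*-congʳ (ι!*invFact i m (NP.m≤n⇒m≤1+n m≤)))) ⟩
        inv1+ i * ι (suc i C m) * ι (k !) * β k * (- a) ^ k * y ^ m
          ≈⟨ solve 6 (λ v c kf b A Y → v :* c :* kf :* b :* A :* Y := v :* c :* (kf :* b) :* A :* Y) refl _ _ _ _ _ _ ⟩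
        weight a m i * y ^ m ∎
        where
        k : ℕ
        k = suc i ∸ m

    atLog-coefficient : ∀ l → ι (l !) * atLog (bernoulliTail ·S expS y) l
                            ≈ Σ< (suc l) (λ i → S₁ l i * Σ< (suc i) (λ m → weight a m i * y ^ m))
    atLog-coefficient l = begin
      ι (l !) * (invFact l * stirlingSum (bernoulliTail ·S expS y) l)
        ≈⟨ trans (sym (*-assoc _ _ _)) (trans (*-congʳ (invFact-inverseʳ l)) (*-identityˡ _)) ⟩
      Σ< (suc l) (λ i → S₁ l i * ι (i !) * (bernoulliTail ·S expS y) i)
        ≈⟨ Σ-cong (suc l) (λ i → trans (*-assoc _ _ _) (*-congˡ (tail·expS-coefficient i))) ⟩
      Σ< (suc l) (λ i → S₁ l i * Σ< (suc i) (λ m → weight a m i * y ^ m)) ∎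

  module _ (r : ℕ) (a : Fin r → Carrier) (a≠0 : ∀ j → ¬ (a j ≈ 0#)) (y : Carrier) where
    Kⱼ : Fin r → Series
    Kⱼ j = atLog (BernoulliIdentity.bernoulliTail F (a j) (a≠0 j) ·S expS y)

    K : Series
    K = ΣS r Kⱼ

    module _ (P : Series) (Dz : ℕ → Carrier) (Dz≈ : ∀ k → Dz k ≈ ι (k !) * P k) (n : ℕ) where
      summand : Fin r → ℕ → ℕ → ℕ → Carrier
      summand j m i l = inv1+ i * ι (n C l) * ι (suc i C m) * S₁ l i * B (suc i ∸ m)
                          * (- a j) ^ (suc i ∸ m) * Dz (n ∸ l)

      H : ℕ → ℕ → ℕ → Carrier
      H m i l = ΣFin r (λ j → summand j m i l)

      factor-term : ∀ j l → ι (n C l) * (ι (l !) * Kⱼ j l) * Dz (n ∸ l)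
                          ≈ Σ< (suc l) (λ i → Σ< (suc i) (λ m → summand j m i l * y ^ m))
      factor-term j l = begin
        ι (n C l) * (ι (l !) * atLog (C₀ ·S expS y) l) * Dz (n ∸ l)
          ≈⟨ *-congʳ (*-congˡ (atLog-coefficient (a j) (a≠0 j) y l)) ⟩
        ι (n C l) * Σ< (suc l) (λ i → S₁ l i * Σ< (suc i) (λ m → weight (a j) m i * y ^ m)) * Dz (n ∸ l)
          ≈⟨ Σ-sandwich (suc l) _ _ _ ⟩
        Σ< (suc l) (λ i → ι (n C l) * (S₁ l i * Σ< (suc i) (λ m → weight (a j) m i * y ^ m)) * Dz (n ∸ l))
          ≈⟨ Σ-cong (suc l) (λ i → trans (*-congʳ (*-congˡ (Σ-*ˡ (suc i) _ _))) (Σ-sandwich (suc i) _ _ _)) ⟩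
        Σ< (suc l) (λ i → Σ< (suc i) (λ m → ι (n C l) * (S₁ l i * (weight (a j) m i * y ^ m)) * Dz (n ∸ l)))
          ≈⟨ Σ-cong (suc l) (λ i → Σ-cong (suc i) (λ m →
               solve 8 (λ v c₁ c₂ s b A Y d → c₁ :* (s :* (v :* c₂ :* b :* A :* Y)) :* d := v :* c₁ :* c₂ :* s :* b :* A :* d :* Y) refl
                 (inv1+ i) (ι (n C l)) (ι (suc i C m)) (S₁ l i) (B (suc i ∸ m)) ((- a j) ^ (suc i ∸ m)) (y ^ m) (Dz (n ∸ l)))) ⟩
        Σ< (suc l) (λ i → Σ< (suc i) (λ m → summand j m i l * y ^ m)) ∎
        where
        C₀ : Series
        C₀ = BernoulliIdentity.bernoulliTail F (a j) (a≠0 j)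

      l-term : ∀ l → l ≤ n → ι (n !) * (K l * P (n ∸ l)) ≈ Σ< (suc l) (λ i → Σ< (suc i) (λ m → H m i l * y ^ m))
      l-term l l≤ = begin
        ι (n !) * (K l * P (n ∸ l))                                ≈⟨ ι!-split l≤ _ _ ⟩
        ι (n C l) * (ι (l !) * K l) * (ι ((n ∸ l) !) * P (n ∸ l))   ≈⟨ *-cong (*-congˡ (ΣFin-*ˡ r _ _)) (sym (Dz≈ (n ∸ l))) ⟩
        ι (n C l) * ΣFin r (λ j → ι (l !) * Kⱼ j l) * Dz (n ∸ l)   ≈⟨ ΣFin-sandwich r _ _ _ ⟩
        ΣFin r (λ j → ι (n C l) * (ι (l !) * Kⱼ j l) * Dz (n ∸ l))  ≈⟨ ΣFin-cong r (λ j → factor-term j l) ⟩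
        ΣFin r (λ j → Σ< (suc l) (λ i → Σ< (suc i) (λ m → summand j m i l * y ^ m))) ≈⟨ ΣFin-Σ r (suc l) _ ⟩
        Σ< (suc l) (λ i → ΣFin r (λ j → Σ< (suc i) (λ m → summand j m i l * y ^ m))) ≈⟨ Σ-cong (suc l) (λ i → ΣFin-Σ r (suc i) _) ⟩
        Σ< (suc l) (λ i → Σ< (suc i) (λ m → ΣFin r (λ j → summand j m i l * y ^ m)))
          ≈⟨ Σ-cong (suc l) (λ i → Σ-cong (suc i) (λ m → sym (ΣFin-*ʳ r _ _))) ⟩
        Σ< (suc l) (λ i → Σ< (suc i) (λ m → H m i l * y ^ m)) ∎

      -- n! [t^n] P K, after reordering the sums over l ≥ i ≥ m
      coefficient : ι (n !) * (P ·S K) n ≈ Σ[ 0 to n ] (λ m → Σ[ m to n ] (λ i → Σ[ i to n ] (λ l → H m i l)) * y ^ m)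
      coefficient = begin
        ι (n !) * (P ·S K) n                                ≈⟨ *-congˡ (·S-comm P K n) ⟩
        ι (n !) * Σ< (suc n) (λ l → K l * P (n ∸ l))        ≈⟨ Σ-*ˡ (suc n) _ _ ⟩
        Σ< (suc n) (λ l → ι (n !) * (K l * P (n ∸ l)))      ≈⟨ Σ-cong< (suc n) (λ l l< → l-term l (NP.≤-pred l<)) ⟩
        Σ< (suc n) (λ l → Σ< (suc l) (λ i → Σ< (suc i) (λ m → H m i l * y ^ m)))
          ≈⟨ Σ-triangle n (λ i l → Σ< (suc i) (λ m → H m i l * y ^ m)) ⟩
        Σ< (suc n) (λ i → Σ[ i to n ] (λ l → Σ< (suc i) (λ m → H m i l * y ^ m)))
          ≈⟨ Σ-cong (suc n) (λ i → Σ-swap (suc n ∸ i) (suc i) (λ k m → H m i (i ℕ.+ k) * y ^ m)) ⟩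
        Σ< (suc n) (λ i → Σ< (suc i) (λ m → Σ[ i to n ] (λ l → H m i l * y ^ m)))
          ≈⟨ Σ-triangle n (λ m i → Σ[ i to n ] (λ l → H m i l * y ^ m)) ⟩
        Σ< (suc n) (λ m → Σ[ m to n ] (λ i → Σ[ i to n ] (λ l → H m i l * y ^ m)))
          ≈⟨ Σ-cong (suc n) (λ m → trans (Σ-cong (suc n ∸ m) (λ k → sym (Σ-*ʳ (suc n ∸ (m ℕ.+ k)) _ _))) (sym (Σ-*ʳ (suc n ∸ m) _ _))) ⟩
        Σ[ 0 to n ] (λ m → Σ[ m to n ] (λ i → Σ[ i to n ] (λ l → H m i l)) * y ^ m) ∎

-- The recurrence for every generating function  P(t) (1+t)^x  whose factors
-- have logarithmic θ-derivatives  cⱼ - Λⱼ ; D and D̂ are the cases cⱼ = 0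
-- and cⱼ = aⱼ.
module Recurrence {c ℓ} (F : Char0Field c ℓ) where
  open import Data.Nat using (ℕ; suc; _∸_; _!)
  open import Data.Nat.Combinatorics using (_C_)
  open import Data.Fin using (Fin)
  open Char0Field F
  open Daehee F
  open Arithmetic F
  open FiniteSums F using (ΣFin-cong)
  open PowerSeries F
  open Derivations F
  open Factorials F
  open AtLog F
  open ExponentialSeries F
  open LogarithmicDerivative F
  module CF = CoefficientFormula F

  coefficientPolynomial : Series → ℕ → Carrier → Carrier
  coefficientPolynomial P n x = ι (n !) * (P ·S binomS x) n

  ι!-∂ : ∀ X n → ι (suc n !) * X (suc n) ≈ ι (n !) * ∂ X n
  ι!-∂ X n = trans (*-congʳ (ι-suc! n)) (solve 3 (λ a b c → a :* b :* c := b :* (a :* c)) refl _ _ _)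

  module _ (r : ℕ) (a : Fin r → Carrier) (a≠0 : ∀ j → ¬ (a j ≈ 0#))
           (gs : Fin r → Series) (cs : Fin r → Carrier)
           (logDerivative : ∀ j → HasLogDerivative (gs j) (cs j ⋅ oneS -S DaeheeFactor.Λ F (a j) (a≠0 j)))
           (n : ℕ) (x : Carrier) where
    private
      y : Carrier
      y = x - 1#
      Λⱼ : Fin r → Series
      Λⱼ j = DaeheeFactor.Λ F (a j) (a≠0 j)
      P Λ K : Series
      P = ΠS r gs
      Λ = ΣS r Λⱼ
      K = CF.K r a a≠0 y

    ∂-P·binomS : ∂ (P ·S binomS x) ≈S (x + ΣFin r cs) ⋅ (P ·S binomS y) -S P ·S (Λ ·S binomS y)
    ∂-P·binomS = ∂-generatingFunction P (ΣFin r cs) Λ x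
      (transS (logDerivative-ΠS r gs (λ j → cs j ⋅ oneS -S Λⱼ j) logDerivative) (·S-congʳ P (ΣS-split r cs Λⱼ)))

    -- Λⱼ(t) (1+t)^y = (C₀ⱼ e^{ys})(ln(1+t))
    Λ·binomS : Λ ·S binomS y ≈S K
    Λ·binomS = transS (ΣS-·S r _ (binomS y)) (λ k → ΣFin-cong r (λ j →
      transS (·S-congʳ _ (symS (atLog-expS y))) (symS (atLog-·S _ (expS y))) k))

    -- the numbers D_k = D_k(0) are k! [t^k] P, as (1+t)^0 = 1
    coefficientPolynomial-at-0 : ∀ k → coefficientPolynomial P k 0# ≈ ι (k !) * P k
    coefficientPolynomial-at-0 k = *-congˡ (transS (·S-congʳ P binomS-zero) (oneS-identityʳ P) k)

    -- compare coefficients of t^n in (P (1+t)^x)'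
    recurrence : coefficientPolynomial P (suc n) x
      ≈ (x + ΣFin r cs) * coefficientPolynomial P n y
        - Σ[ 0 to n ] (λ m →
            Σ[ m to n ] (λ i → Σ[ i to n ] (λ l → ΣFin r (λ j →
              inv1+ i * ι (n C l) * ι (suc i C m) * S₁ l i * B (suc i ∸ m)
                * (- a j) ^ (suc i ∸ m) * coefficientPolynomial P (n ∸ l) 0#)))
            * y ^ m)
    recurrence = begin
      ι (suc n !) * (P ·S binomS x) (suc n)     ≈⟨ ι!-∂ (P ·S binomS x) n ⟩
      ι (n !) * ∂ (P ·S binomS x) n             ≈⟨ *-congˡ (∂-P·binomS n) ⟩
      ι (n !) * ((x + ΣFin r cs) * (P ·S binomS y) n - (P ·S (Λ ·S binomS y)) n)
        ≈⟨ solve 4 (λ f X Q R → f :* (X :* Q :- R) := X :* (f :* Q) :- f :* R) refl _ _ _ _ ⟩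
      (x + ΣFin r cs) * coefficientPolynomial P n y - ι (n !) * (P ·S (Λ ·S binomS y)) n
        ≈⟨ +-congˡ (-‿cong (*-congˡ (·S-congʳ P Λ·binomS n))) ⟩
      (x + ΣFin r cs) * coefficientPolynomial P n y - ι (n !) * (P ·S K) n
        ≈⟨ +-congˡ (-‿cong (CF.coefficient r a a≠0 y P _ coefficientPolynomial-at-0 n)) ⟩
      _ ∎

-- Theorem 4: the factors ln(1+t)/((1+t)^{aⱼ}-1) have logarithmic θ-derivative
-- 0 - Λⱼ, and the factors (1+t)^{aⱼ} ln(1+t)/((1+t)^{aⱼ}-1) have aⱼ - Λⱼ.
theorem4 : ∀ {c ℓ} (F : Char0Field c ℓ) →
  let open Char0Field F
      open Daehee F
  in (r : ℕ) → 1 ≤ r → (a : Fin r → Carrier) (a≠0 : ∀ j → ¬ (a j ≈ 0#)) (n : ℕ) (x : Carrier) →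
     (D r a a≠0 (suc n) x
        ≈ x * D r a a≠0 n (x - 1#)
          - Σ[ 0 to n ] (λ m →
              Σ[ m to n ] (λ i → Σ[ i to n ] (λ l → ΣFin r (λ j →
                inv1+ i * ι (n C l) * ι (suc i C m) * S₁ l i * B (suc i ∸ m)
                  * (- a j) ^ (suc i ∸ m) * D r a a≠0 (n ∸ l) 0#)))
              * (x - 1#) ^ m))
     × (D̂ r a a≠0 (suc n) x
        ≈ (x + ΣFin r a) * D̂ r a a≠0 n (x - 1#)
          - Σ[ 0 to n ] (λ m →
              Σ[ m to n ] (λ i → Σ[ i to n ] (λ l → ΣFin r (λ j →
                inv1+ i * ι (n C l) * ι (suc i C m) * S₁ l i * B (suc i ∸ m)
                  * (- a j) ^ (suc i ∸ m) * D̂ r a a≠0 (n ∸ l) 0#)))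
              * (x - 1#) ^ m))
theorem4 F r _ a a≠0 n x =
    trans (Recurrence.recurrence F r a a≠0 (λ j → daeheeFactor (a j) (a≠0 j)) (λ _ → 0#)
             (λ j → DaeheeFactor.logDerivative-first F (a j) (a≠0 j)) n x)
          (+-congʳ (*-congʳ (trans (+-congˡ (ΣFin-0 r)) (+-identityʳ x))))
  , Recurrence.recurrence F r a a≠0 (λ j → binomS (a j) ·S daeheeFactor (a j) (a≠0 j)) a
      (λ j → DaeheeFactor.logDerivative-second F (a j) (a≠0 j)) n x
  where
  open Char0Field F
  open Daehee F
  open FiniteSums F using (ΣFin-0)
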